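{- Let $H=(V,E)$ be a hypergraph with edge family $E=(e_i)_{i\in I}$ (all hyperedges nonempty), and let $\xi(H;x,y,z,\mathbf{t})$ be its multivariate hyperedge elimination polynomial. Then: (1) $\xi(E_0;x,y,z,\mathbf{t})=1$, where $E_0$ is the hypergraph with no vertices and no edges; (2) $\xi(E_1;x,y,z,\mathbf{t})=x$, where $E_1$ is the hypergraph with one vertex and no edges; (3) $\xi(H_1\sqcup H_2;x,y,z,\mathbf{t})=\xi(H_1;x,y,z,\mathbf{t})\cdot\xi(H_2;x,y,z,\mathbf{t})$ for the disjoint union of two hypergraphs; (4) for every edge $e_i$ of $H$, $$\xi(H;x,y,z,\mathbf{t})=\xi(H-e_i;x,y,z,\mathbf{t}_{\neq e_i})+y\,t_i\,\xi(H/e_i;x,y,z,\mathbf{t}_{\neq e_i})+z\,t_i\,\xi(H\dagger e_i;x,y,z,\mathbf{t}_{\perp e_i}),$$ where $\mathbf{t}_{\neq e_i}=(t_j)_{j\in I\setminus\{i\}}$ and $\mathbf{t}_{\perp e_i}=(t_j)_{j\in I\setminus\{i\},\,e_j\cap e_i=\emptyset}$.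
   Context: A hypergraph $H=(V,E)$ consists of a finite vertex set $V$ and a finite indexed family $E=(e_i)_{i\in I}$ of subsets of $V$ (hyperedges); distinct indices may carry equal sets (parallel edges). Here all hyperedges are nonempty. For $J\subseteq I$ write $E_J=(e_j)_{j\in J}$; the partial hypergraph is $H_J=(V,E_J)$, and the edge section hypergraph $H\times J$ has vertex set $\bigcup_{j\in J}e_j$ and edge family $E_J$. For a hypergraph $G$, $k(G)$ is its number of connected components (two vertices lie in the same component if they are joined by a sequence of vertices in which consecutive vertices lie in a common hyperedge); a hypergraph with no vertices has $0$ components. A pair $(A,B)$ of disjoint subsets of $I$ is a vertex disjoint pair if $e_a\cap e_b=\emptyset$ for all $a\in A$, $b\in B$. With an indeterminate $t_i$ for each $i\in I$, $$\xi(H;x,y,z,\mathbf{t})=\sum_{(A,B)} x^{k(H_{A\sqcup B})-k(H\times B)}\,y^{|A|+|B|-k(H\times B)}\,z^{k(H\times B)}\prod_{i\in A\sqcup B}t_i,$$ the sum over all vertex disjoint pairs $(A,B)$. For an edge $e_i$: the deletion is $H-e_i=(V,(e_j)_{j\in I\setminus\{i\}})$; the extraction is $H\dagger e_i=(V\setminus e_i,(e_j)_{j\neq i,\ e_j\cap e_i=\emptyset})$; the contraction $H/e_i$ has vertex set $(V\setminus e_i)\cup\{v_i\}$ with $v_i$ a new vertex, and edges indexed by $j\in I\setminus\{i\}$, namely $e_j$ if $e_j\cap e_i=\emptyset$ and $(e_j\setminus e_i)\cup\{v_i\}$ otherwise. In the polynomials of these smaller hypergraphs, the edge with index $j$ carries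 the indeterminate $t_j$. -}

module Defs where

open import Level using (Level)
open import Function using (_∘_)
open import Data.Bool using (Bool; true; false; _∧_; _∨_; not; if_then_else_; T)
open import Data.Nat as ℕ using (ℕ; zero; suc; _∸_; _<ᵇ_)
open import Data.Fin using (Fin; zero; suc; toℕ; splitAt; _≟_)
open import Data.Sum using (inj₁; inj₂; [_,_])
open import Data.Product using (_×_; ∃)
open import Data.List using (List; []; _∷_; map; foldr; allFin; lookup; length; concatMap)
open import Data.Bool.ListAction using (any; all)
open import Relation.Nullary.Decidable using (⌊_⌋)
open import Algebra.Bundles using (CommutativeRing)

BSub : ℕ → Set
BSub n = Fin n → Bool

anyFin : ∀ {n} → (Fin n → Bool) → Bool
anyFin {n} p = any p (allFin n)

allFin? : ∀ {n} → (Fin n → Bool) → Bool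
allFin? {n} p = all p (allFin n)

sel : ∀ {m} → (Fin m → Bool) → List (Fin m)
sel {m} p = foldr (λ j js → if p j then j ∷ js else js) [] (allFin m)

countFin : ∀ {n} → (Fin n → Bool) → ℕ
countFin p = length (sel p)

disjointB : ∀ {n} → BSub n → BSub n → Bool
disjointB f g = not (anyFin (λ v → f v ∧ g v))

-- Number of connected components of the hypergraph with vertex set W
-- (a subset of Fin n) and edge list es (each edge assumed ⊆ W).

module _ {n : ℕ} (es : List (BSub n)) where

  adjB : Fin n → Fin n → Bool
  adjB u v = any (λ f → f u ∧ f v) es

  reachB : ℕ → Fin n → Fin n → Bool
  reachB zero    u v = ⌊ u ≟ v ⌋
  reachB (suc k) u v = reachB k u v ∨ anyFin (λ w → reachB k u w ∧ adjB w v)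

  -- connectedness (walks of length ≤ n suffice on n vertices)
  connB : Fin n → Fin n → Bool
  connB = reachB n

-- k(W, es): count the vertices of W which are the least vertex of their
-- component, i.e. the number of components.
components : ∀ {n} → BSub n → List (BSub n) → ℕ
components W es =
  countFin (λ v → W v ∧ not (anyFin (λ u → W u ∧ (toℕ u <ᵇ toℕ v) ∧ connB es u v)))

record Hypergraph : Set where
  field
    n : ℕ
    V : BSub n
    m : ℕ
    e : Fin m → BSub n
open Hypergraph public

WellFormed : Hypergraph → Set
WellFormed H = (∀ j v → T (e H j v) → T (V H v)) × (∀ j → ∃ λ v → T (e H j v))

E₀ : Hypergraph
E₀ = record { n = 0 ; V = λ () ; m = 0 ; e = λ () }

E₁ : Hypergraph
E₁ = record { n = 1 ; V = λ _ → true ; m = 0 ; e = λ () }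

_⊔ᴴ_ : Hypergraph → Hypergraph → Hypergraph
H₁ ⊔ᴴ H₂ = record
  { n = n H₁ ℕ.+ n H₂
  ; V = [ V H₁ , V H₂ ] ∘ splitAt (n H₁)
  ; m = m H₁ ℕ.+ m H₂
  ; e = [ (λ a → [ e H₁ a , (λ _ → false) ] ∘ splitAt (n H₁))
        , (λ b → [ (λ _ → false) , e H₂ b ] ∘ splitAt (n H₁)) ] ∘ splitAt (m H₁)
  }

joinW : ∀ {a} {A : Set a} (H₁ H₂ : Hypergraph) →
        (Fin (m H₁) → A) → (Fin (m H₂) → A) → Fin (m (H₁ ⊔ᴴ H₂)) → A
joinW H₁ H₂ t₁ t₂ = [ t₁ , t₂ ] ∘ splitAt (m H₁)

neqIdx : (H : Hypergraph) → Fin (m H) → List (Fin (m H))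
neqIdx H i = sel (λ j → not ⌊ j ≟ i ⌋)

perpIdx : (H : Hypergraph) → Fin (m H) → List (Fin (m H))
perpIdx H i = sel (λ j → not ⌊ j ≟ i ⌋ ∧ disjointB (e H j) (e H i))

deletion : (H : Hypergraph) → Fin (m H) → Hypergraph
deletion H i = record
  { n = n H ; V = V H ; m = length (neqIdx H i) ; e = e H ∘ lookup (neqIdx H i) }

extraction : (H : Hypergraph) → Fin (m H) → Hypergraph
extraction H i = record
  { n = n H
  ; V = λ v → V H v ∧ not (e H i v)
  ; m = length (perpIdx H i)
  ; e = e H ∘ lookup (perpIdx H i)
  }

-- contraction H / e_i ; the new vertex v_i is zero, old vertex v is suc v
contraction : (H : Hypergraph) → Fin (m H) → Hypergraph
contraction H i = record
  { n = suc (n H)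
  ; V = newV
  ; m = length (neqIdx H i)
  ; e = newE ∘ lookup (neqIdx H i)
  }
  where
  newV : BSub (suc (n H))
  newV zero    = true
  newV (suc v) = V H v ∧ not (e H i v)
  newE : Fin (m H) → BSub (suc (n H))
  newE j zero    = not (disjointB (e H j) (e H i))
  newE j (suc v) = if disjointB (e H j) (e H i) then e H j v else (e H j v ∧ not (e H i v))

-- Pairs (A,B) of disjoint subsets of Fin m, encoded as labellings.

data Lbl : Set where
  out inA inB : Lbl

isA isB isAB : Lbl → Bool
isA inA = true
isA _   = false
isB inB = true
isB _   = false
isAB out = false
isAB _   = true

consL : ∀ {m} → Lbl → (Fin m → Lbl) → Fin (suc m) → Lbl
consL l σ zero    = l
consL l σ (suc j) = σ j

labellings : (m : ℕ) → List (Fin m → Lbl)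
labellings zero    = (λ ()) ∷ []
labellings (suc m) = concatMap (λ σ → consL out σ ∷ consL inA σ ∷ consL inB σ ∷ []) (labellings m)

vdPair : (H : Hypergraph) → (Fin (m H) → Lbl) → Bool
vdPair H σ = allFin? (λ a → allFin? (λ b →
  not (isA (σ a) ∧ isB (σ b)) ∨ disjointB (e H a) (e H b)))

-- The multivariate hyperedge elimination polynomial, evaluated at
-- x, y, z, t in an arbitrary commutative ring.

module _ {c ℓ} (R : CommutativeRing c ℓ) where
  open CommutativeRing R

  pow : Carrier → ℕ → Carrier
  pow a zero    = 1#
  pow a (suc k) = a * pow a k

  ξ : (H : Hypergraph) → (x y z : Carrier) → (Fin (m H) → Carrier) → Carrier
  ξ H x y z t = foldr (λ σ acc → (if vdPair H σ then term σ else 0#) + acc) 0# (labellings (m H))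
    where
    term : (Fin (m H) → Lbl) → Carrier
    term σ =
      let AB   = sel (λ j → isAB (σ j))
          Bs   = sel (λ j → isB (σ j))
          kAB  = components (V H) (map (e H) AB)
          kB   = components (λ v → any (λ j → e H j v) Bs) (map (e H) Bs)
      in pow x (kAB ∸ kB) * pow y (length AB ∸ kB) * pow z kB
         * foldr (λ j acc → t j * acc) 1# AB

-- ξ is a sum over labellings of the edges by out, A and B, and each summand is
-- determined by the numbers of components of H_{A⊔B} and of H × B, which we
-- count as classes of the reachability relation.  For a disjoint union a
-- labelling is a pair of labellings, vertex disjointness and all the counts
-- split, and the summands multiply.  For the recurrence at the edge eᵢ we group
-- the labellings in triples that differ only at i.  The member with i out is a
-- summand of H − eᵢ.  Putting i into A or B either destroys vertex disjointness,
-- or changes the counts exactly as contracting eᵢ does (a summand of H / eᵢ,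
-- times y tᵢ), or, when i goes to B and no other edge of A ⊔ B meets eᵢ, adds eᵢ
-- as a new component of both H_{A⊔B} and H × B (a summand of H † eᵢ, times
-- z tᵢ).  Summing over labellings that put the missing edges out gives the
-- polynomials of the smaller hypergraphs.

module Submission where

open import Defs
open import Function using (_∘_; id)
open import Function.Bundles using (Equivalence)
open import Data.Bool using (Bool; true; false; _∧_; _∨_; not; if_then_else_; T)
open import Data.Bool.Properties using (∧-zeroʳ; ∧-identityʳ; ∨-identityʳ; ∨-assoc; T-∧; T-∨; T-≡)
open import Data.Bool.ListAction using (any; all; or; and)
open import Data.Nat as ℕ using (ℕ; zero; suc; _∸_; _<ᵇ_; _≤_; z≤n; s≤s)
import Data.Nat.Properties as ℕP
open ℕP using (≤-refl; ≤-trans; ≤-reflexive; n≤1+n; +-suc; m∸n+n≡m; m≤m+n)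
open import Data.Fin using (Fin; zero; suc; toℕ; splitAt; _↑ˡ_; _↑ʳ_; join; _≟_)
open import Data.Fin.Properties using (splitAt-↑ˡ; splitAt-↑ʳ; join-splitAt)
open import Data.List using (List; []; _∷_; map; foldr; allFin; lookup; length; _++_; concatMap)
open import Data.List.Properties using (map-tabulate; map-∘; length-map; tabulate-lookup; map-id; map-++; length-++)
open import Data.List.Membership.Propositional using (_∈_; find; lose)
open import Data.List.Membership.Propositional.Properties using (∈-allFin; ∈-map⁺; ∈-map⁻; ∈-++⁻; ∈-++⁺ˡ; ∈-++⁺ʳ)
open import Data.List.Relation.Unary.Any using (here; there)
open import Data.List.Relation.Unary.All using (All; []; _∷_)
open import Data.List.Relation.Unary.Any.Properties using (any⁺; any⁻)
open import Data.Product using (_×_; _,_; Σ; proj₁; proj₂)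
open import Data.Sum using (_⊎_; inj₁; inj₂; [_,_]; [_,_]′)
open import Data.Empty using (⊥; ⊥-elim)
open import Data.Unit using (tt)
open import Relation.Nullary using (¬_; yes; no)
open import Relation.Nullary.Decidable using (⌊_⌋; toWitness; fromWitness)
open import Relation.Binary.PropositionalEquality using (_≡_; refl; sym; trans; cong; cong₂; subst; subst₂; module ≡-Reasoning)
open import Algebra.Bundles using (CommutativeRing)
import Algebra.Solver.CommutativeMonoid as CMS

T-∧⁺ : ∀ {a b} → T a → T b → T (a ∧ b)
T-∧⁺ {a} {b} p q = Equivalence.from (T-∧ {a} {b}) (p , q)

T-∧⁻ˡ : ∀ {a b} → T (a ∧ b) → T a
T-∧⁻ˡ {a} {b} = proj₁ ∘ Equivalence.to (T-∧ {a} {b})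

T-∧⁻ʳ : ∀ {a b} → T (a ∧ b) → T b
T-∧⁻ʳ {a} {b} = proj₂ ∘ Equivalence.to (T-∧ {a} {b})

T-∨⁺ˡ : ∀ {a b} → T a → T (a ∨ b)
T-∨⁺ˡ {a} {b} = Equivalence.from (T-∨ {a} {b}) ∘ inj₁

T-∨⁺ʳ : ∀ {a b} → T b → T (a ∨ b)
T-∨⁺ʳ {a} {b} = Equivalence.from (T-∨ {a} {b}) ∘ inj₂

T-∨⁻ : ∀ {a b} → T (a ∨ b) → T a ⊎ T b
T-∨⁻ {a} {b} = Equivalence.to (T-∨ {a} {b})

T-not⁺ : ∀ {a} → (T a → ⊥) → T (not a)
T-not⁺ {true} f = f tt
T-not⁺ {false} f = tt

T-not⁻ : ∀ {a} → T (not a) → T a → ⊥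
T-not⁻ {true} () _
T-not⁻ {false} _ ()

T-not-not⁻ : ∀ {b} → T (not (not b)) → T b
T-not-not⁻ {true} _ = tt

T-dec : ∀ b → T b ⊎ (T b → ⊥)
T-dec true = inj₁ tt
T-dec false = inj₂ (λ ())

T-ext : ∀ {a b} → (T a → T b) → (T b → T a) → a ≡ b
T-ext {true} {true} f g = refl
T-ext {true} {false} f g = ⊥-elim (f tt)
T-ext {false} {true} f g = ⊥-elim (g tt)
T-ext {false} {false} f g = refl

T⇒≡true : ∀ {a} → T a → a ≡ true
T⇒≡true = Equivalence.to T-≡

¬T⇒≡false : ∀ {a} → (T a → ⊥) → a ≡ false
¬T⇒≡false {true} f = ⊥-elim (f tt)
¬T⇒≡false {false} f = refl

≡true⇒T : ∀ {a} → a ≡ true → T a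
≡true⇒T = Equivalence.from T-≡

filterB : ∀ {a} {A : Set a} → (A → Bool) → List A → List A
filterB p = foldr (λ j js → if p j then j ∷ js else js) []

filterB-map : ∀ {a b} {A : Set a} {B : Set b} (p : B → Bool) (f : A → B) (L : List A) →
  filterB p (map f L) ≡ map f (filterB (p ∘ f) L)
filterB-map p f [] = refl
filterB-map p f (x ∷ L) with p (f x)
... | true = cong (f x ∷_) (filterB-map p f L)
... | false = filterB-map p f L

filterB-cong : ∀ {a} {A : Set a} {p q : A → Bool} → (∀ x → p x ≡ q x) → (L : List A) → filterB p L ≡ filterB q L
filterB-cong h [] = refl
filterB-cong {p = p} {q} h (x ∷ L) rewrite h x with q x
... | true = cong (x ∷_) (filterB-cong h L)
... | false = filterB-cong h L

sel-cong : ∀ {m} {p q : Fin m → Bool} → (∀ x → p x ≡ q x) → sel p ≡ sel q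
sel-cong {m} h = filterB-cong h (allFin m)

sel-suc : ∀ {m} (p : Fin (suc m) → Bool) →
  sel p ≡ (if p zero then zero ∷ map suc (sel (p ∘ suc)) else map suc (sel (p ∘ suc)))
sel-suc {m} p with p zero
... | true = cong (zero ∷_) (trans (cong (filterB p) (sym (map-tabulate id suc))) (filterB-map p suc (allFin m)))
... | false = trans (cong (filterB p) (sym (map-tabulate id suc))) (filterB-map p suc (allFin m))

filterB-filterB : ∀ {a} {A : Set a} (p q : A → Bool) (L : List A) →
  filterB p (filterB q L) ≡ filterB (λ x → q x ∧ p x) L
filterB-filterB p q [] = refl
filterB-filterB p q (x ∷ L) with q x
... | false = filterB-filterB p q L
... | true with p x
...   | true = cong (x ∷_) (filterB-filterB p q L)
...   | false = filterB-filterB p q L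

map-lookup-sel : ∀ {a} {A : Set a} (p : A → Bool) (L : List A) →
  map (lookup L) (sel (p ∘ lookup L)) ≡ filterB p L
map-lookup-sel p [] = refl
map-lookup-sel p (x ∷ L) rewrite sel-suc (p ∘ lookup (x ∷ L)) with p x
... | true = cong (x ∷_) (trans (sym (map-∘ (sel (p ∘ lookup L)))) (map-lookup-sel p L))
... | false = trans (sym (map-∘ (sel (p ∘ lookup L)))) (map-lookup-sel p L)

any-map : ∀ {a b} {A : Set a} {B : Set b} (p : B → Bool) (f : A → B) (L : List A) →
  any p (map f L) ≡ any (p ∘ f) L
any-map p f [] = refl
any-map p f (x ∷ L) = cong (p (f x) ∨_) (any-map p f L)

any-filterB : ∀ {a} {A : Set a} (p q : A → Bool) (L : List A) →
  any p (filterB q L) ≡ any (λ x → q x ∧ p x) L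
any-filterB p q [] = refl
any-filterB p q (x ∷ L) with q x
... | true = cong (p x ∨_) (any-filterB p q L)
... | false = any-filterB p q L

any-intro : ∀ {a} {A : Set a} (p : A → Bool) {L : List A} {x} → x ∈ L → T (p x) → T (any p L)
any-intro p m px = any⁺ p (lose m px)

any-elim : ∀ {a} {A : Set a} (p : A → Bool) (L : List A) → T (any p L) → Σ A λ x → x ∈ L × T (p x)
any-elim p L h = find (any⁻ p L h)

all-intro : ∀ {a} {A : Set a} (p : A → Bool) (L : List A) → (∀ x → x ∈ L → T (p x)) → T (all p L)
all-intro p [] h = tt
all-intro p (x ∷ L) h = T-∧⁺ (h x (here refl)) (all-intro p L (λ y m → h y (there m)))

all-elim : ∀ {a} {A : Set a} (p : A → Bool) {L : List A} → T (all p L) → ∀ x → x ∈ L → T (p x)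
all-elim p {y ∷ L} h x (here refl) = T-∧⁻ˡ h
all-elim p {y ∷ L} h x (there m) = all-elim p (T-∧⁻ʳ {p y} h) x m

∈-filterB : ∀ {a} {A : Set a} (q : A → Bool) {x} (L : List A) → x ∈ L → T (q x) → x ∈ filterB q L
∈-filterB q (y ∷ L) (here refl) qx with q y
... | true = here refl
∈-filterB q (y ∷ L) (there m) qx with q y
... | true = there (∈-filterB q L m qx)
... | false = ∈-filterB q L m qx

∈-filterB⁻ : ∀ {a} {A : Set a} (q : A → Bool) {x} (L : List A) → x ∈ filterB q L → x ∈ L × T (q x)
∈-filterB⁻ q (y ∷ L) m with q y in eq
∈-filterB⁻ q (y ∷ L) (here refl) | true = here refl , ≡true⇒T eq
∈-filterB⁻ q (y ∷ L) (there m) | true with ∈-filterB⁻ q L m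
... | a , b = there a , b
∈-filterB⁻ q (y ∷ L) m | false with ∈-filterB⁻ q L m
... | a , b = there a , b

∈-sel : ∀ {m} (p : Fin m → Bool) {x} → T (p x) → x ∈ sel p
∈-sel {m} p px = ∈-filterB p (allFin m) (∈-allFin _) px

∈-sel⁻ : ∀ {m} (p : Fin m → Bool) {x} → x ∈ sel p → T (p x)
∈-sel⁻ {m} p h = proj₂ (∈-filterB⁻ p (allFin m) h)

anyFin-intro : ∀ {n} (p : Fin n → Bool) v → T (p v) → T (anyFin p)
anyFin-intro p v pv = any-intro p (∈-allFin v) pv

anyFin-elim : ∀ {n} (p : Fin n → Bool) → T (anyFin p) → Σ (Fin n) λ v → T (p v)
anyFin-elim {n} p h with any-elim p (allFin n) h
... | v , _ , pv = v , pv

allFin-intro : ∀ {n} (p : Fin n → Bool) → (∀ v → T (p v)) → T (allFin? p)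
allFin-intro {n} p h = all-intro p (allFin n) (λ v _ → h v)

allFin-elim : ∀ {n} (p : Fin n → Bool) → T (allFin? p) → ∀ v → T (p v)
allFin-elim {n} p h v = all-elim p h v (∈-allFin v)

anyFin-cong : ∀ {n} {p q : Fin n → Bool} → (∀ v → p v ≡ q v) → anyFin p ≡ anyFin q
anyFin-cong {p = p} {q} h = T-ext (λ t → let (v , pv) = anyFin-elim p t in anyFin-intro q v (subst T (h v) pv))
                                   (λ t → let (v , qv) = anyFin-elim q t in anyFin-intro p v (subst T (sym (h v)) qv))

allFin-cong : ∀ {n} {p q : Fin n → Bool} → (∀ v → p v ≡ q v) → allFin? p ≡ allFin? q
allFin-cong {p = p} {q} h = T-ext (λ t → allFin-intro q λ v → subst T (h v) (allFin-elim p t v))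
                                   (λ t → allFin-intro p λ v → subst T (sym (h v)) (allFin-elim q t v))

countFin-suc : ∀ {n} (p : Fin (suc n) → Bool) →
  countFin p ≡ (if p zero then suc (countFin (p ∘ suc)) else countFin (p ∘ suc))
countFin-suc p rewrite sel-suc p with p zero
... | true = cong suc (length-map suc (sel (p ∘ suc)))
... | false = length-map suc (sel (p ∘ suc))

countFin-cong : ∀ {n} {p q : Fin n → Bool} → (∀ v → p v ≡ q v) → countFin p ≡ countFin q
countFin-cong h = cong length (sel-cong h)

countFin-≤ : ∀ {n} (p : Fin n → Bool) → countFin p ≤ n
countFin-≤ {zero} p = z≤n
countFin-≤ {suc n} p rewrite countFin-suc p with p zero
... | true = s≤s (countFin-≤ (p ∘ suc))
... | false = ≤-trans (countFin-≤ (p ∘ suc)) (n≤1+n n)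

countFin-mono : ∀ {n} (p q : Fin n → Bool) → (∀ v → T (p v) → T (q v)) → countFin p ≤ countFin q
countFin-mono {zero} p q h = z≤n
countFin-mono {suc n} p q h rewrite countFin-suc p | countFin-suc q with p zero in ep | q zero in eq
... | true | true = s≤s (countFin-mono (p ∘ suc) (q ∘ suc) (h ∘ suc))
... | true | false = ⊥-elim (subst T eq (h zero (subst T (sym ep) tt)))
... | false | true = ≤-trans (countFin-mono (p ∘ suc) (q ∘ suc) (h ∘ suc)) (n≤1+n _)
... | false | false = countFin-mono (p ∘ suc) (q ∘ suc) (h ∘ suc)

countFin-strict : ∀ {n} (p q : Fin n → Bool) → (∀ v → T (p v) → T (q v)) →
  ∀ v → T (q v) → (T (p v) → ⊥) → suc (countFin p) ≤ countFin q
countFin-strict {suc n} p q h v qv npv rewrite countFin-suc p | countFin-suc q with p zero in ep | q zero in eq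
countFin-strict {suc n} p q h zero qv npv | true | _ = ⊥-elim (npv (subst T (sym ep) tt))
countFin-strict {suc n} p q h zero qv npv | false | true = s≤s (countFin-mono (p ∘ suc) (q ∘ suc) (h ∘ suc))
countFin-strict {suc n} p q h zero qv npv | false | false = ⊥-elim (subst T eq qv)
countFin-strict {suc n} p q h (suc v) qv npv | true | true = s≤s (countFin-strict (p ∘ suc) (q ∘ suc) (h ∘ suc) v qv npv)
countFin-strict {suc n} p q h (suc v) qv npv | true | false = ⊥-elim (subst T eq (h zero (subst T (sym ep) tt)))
countFin-strict {suc n} p q h (suc v) qv npv | false | true = ≤-trans (countFin-strict (p ∘ suc) (q ∘ suc) (h ∘ suc) v qv npv) (n≤1+n _)
countFin-strict {suc n} p q h (suc v) qv npv | false | false = countFin-strict (p ∘ suc) (q ∘ suc) (h ∘ suc) v qv npv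

countFin-pos : ∀ {n} (p : Fin n → Bool) v → T (p v) → 1 ≤ countFin p
countFin-pos {n} p v pv = subst (λ k → suc k ≤ countFin p) (countFin-false n) (countFin-strict {n} (λ _ → false) p (λ _ ()) v pv (λ ()))
  where
  countFin-false : ∀ n → countFin {n} (λ _ → false) ≡ 0
  countFin-false zero = refl
  countFin-false (suc n) = trans (countFin-suc {n} (λ _ → false)) (countFin-false n)

splitAt-view : ∀ m1 {m2} (j : Fin (m1 ℕ.+ m2)) → (Σ (Fin m1) λ a → j ≡ a ↑ˡ m2) ⊎ (Σ (Fin m2) λ b → j ≡ m1 ↑ʳ b)
splitAt-view m1 {m2} j with splitAt m1 j in eq
... | inj₁ a = inj₁ (a , trans (sym (join-splitAt m1 m2 j)) (cong (join m1 m2) eq))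
... | inj₂ b = inj₂ (b , trans (sym (join-splitAt m1 m2 j)) (cong (join m1 m2) eq))

joinLabels : ∀ {a} {A : Set a} m1 {m2} → (Fin m1 → A) → (Fin m2 → A) → Fin (m1 ℕ.+ m2) → A
joinLabels m1 σ1 σ2 = [ σ1 , σ2 ] ∘ splitAt m1

joinLabels-↑ˡ : ∀ {a} {A : Set a} m1 {m2} (σ1 : Fin m1 → A) (σ2 : Fin m2 → A) u → joinLabels m1 σ1 σ2 (u ↑ˡ m2) ≡ σ1 u
joinLabels-↑ˡ m1 {m2} σ1 σ2 u rewrite splitAt-↑ˡ m1 u m2 = refl

joinLabels-↑ʳ : ∀ {a} {A : Set a} m1 {m2} (σ1 : Fin m1 → A) (σ2 : Fin m2 → A) u → joinLabels m1 σ1 σ2 (m1 ↑ʳ u) ≡ σ2 u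
joinLabels-↑ʳ m1 {m2} σ1 σ2 u rewrite splitAt-↑ʳ m1 m2 u = refl

sel-join : ∀ m1 {m2} (p : Fin (m1 ℕ.+ m2) → Bool) → sel p ≡ map (_↑ˡ m2) (sel (p ∘ (_↑ˡ m2))) ++ map (m1 ↑ʳ_) (sel (p ∘ (m1 ↑ʳ_)))
sel-join-eqn : ∀ m1 m2 (S1 : List (Fin m1)) (S2 : List (Fin m2)) →
  map suc (map (_↑ˡ m2) S1 ++ map (m1 ↑ʳ_) S2) ≡ map (_↑ˡ m2) (map suc S1) ++ map (suc m1 ↑ʳ_) S2
sel-join-eqn m1 m2 S1 S2 = trans (map-++ suc (map (_↑ˡ m2) S1) (map (m1 ↑ʳ_) S2))
          (cong₂ _++_ (trans (sym (map-∘ {g = suc} {f = _↑ˡ m2} S1)) (map-∘ {g = _↑ˡ m2} {f = suc} S1))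
                        (sym (map-∘ {g = suc} {f = m1 ↑ʳ_} S2)))

sel-join zero p = sym (map-id (sel p))
sel-join (suc m1) {m2} p rewrite sel-suc p | sel-suc (p ∘ (_↑ˡ m2)) | sel-join m1 (p ∘ suc) with p zero
... | true = cong (zero ∷_) (sel-join-eqn m1 m2 (sel (p ∘ suc ∘ (_↑ˡ m2))) (sel (p ∘ suc ∘ (m1 ↑ʳ_))))
... | false = sel-join-eqn m1 m2 (sel (p ∘ suc ∘ (_↑ˡ m2))) (sel (p ∘ suc ∘ (m1 ↑ʳ_)))

+-∸-+ : ∀ {a1 a2 b1 b2} → b1 ≤ a1 → b2 ≤ a2 → (a1 ℕ.+ a2) ∸ (b1 ℕ.+ b2) ≡ (a1 ∸ b1) ℕ.+ (a2 ∸ b2)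
+-∸-+ {a1} {a2} {b1} {b2} h1 h2 = begin
  (a1 ℕ.+ a2) ∸ (b1 ℕ.+ b2) ≡⟨ sym (ℕP.∸-+-assoc (a1 ℕ.+ a2) b1 b2) ⟩
  (a1 ℕ.+ a2) ∸ b1 ∸ b2     ≡⟨ cong (_∸ b2) (ℕP.+-∸-comm a2 h1) ⟩
  (a1 ∸ b1 ℕ.+ a2) ∸ b2     ≡⟨ ℕP.+-∸-assoc (a1 ∸ b1) h2 ⟩
  (a1 ∸ b1) ℕ.+ (a2 ∸ b2)   ∎
  where open ≡-Reasoning

any-++ : ∀ {a} {A : Set a} (p : A → Bool) L M → any p (L ++ M) ≡ (any p L ∨ any p M)
any-++ p [] M = refl
any-++ p (x ∷ L) M rewrite any-++ p L M = sym (∨-assoc (p x) (any p L) (any p M))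

any-false : ∀ {a} {A : Set a} (L : List A) → any (λ _ → false) L ≡ false
any-false [] = refl
any-false (x ∷ L) = any-false L

-- Connectivity

data Path {n} (es : List (BSub n)) : Fin n → Fin n → Set where
  here : ∀ {u} → Path es u u
  step : ∀ {u w v} → T (adjB es u w) → Path es w v → Path es u v

path-++ : ∀ {n} {es : List (BSub n)} {u w v} → Path es u w → Path es w v → Path es u v
path-++ here q = q
path-++ (step a p) q = step a (path-++ p q)

path-snoc : ∀ {n} {es : List (BSub n)} {u w v} → Path es u w → T (adjB es w v) → Path es u v
path-snoc p a = path-++ p (step a here)

adj-sym : ∀ {n} (es : List (BSub n)) u v → T (adjB es u v) → T (adjB es v u)
adj-sym es u v h with any-elim (λ f → f u ∧ f v) es h
... | f , m , t = any-intro (λ f → f v ∧ f u) m (T-∧⁺ (T-∧⁻ʳ {f u} t) (T-∧⁻ˡ t))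

path-rev : ∀ {n} {es : List (BSub n)} {u v} → Path es u v → Path es v u
path-rev here = here
path-rev {es = es} (step {u} {w} a p) = path-snoc (path-rev p) (adj-sym es u w a)

path-map : ∀ {n n'} {es : List (BSub n)} {es' : List (BSub n')} (φ : Fin n → Fin n') →
  (∀ a b → T (adjB es a b) → Path es' (φ a) (φ b)) → ∀ {u v} → Path es u v → Path es' (φ u) (φ v)
path-map φ h here = here
path-map φ h (step a p) = path-++ (h _ _ a) (path-map φ h p)

≟-refl : ∀ {n} (u : Fin n) → T ⌊ u ≟ u ⌋
≟-refl u = fromWitness refl

≟-sound : ∀ {n} {u v : Fin n} → T ⌊ u ≟ v ⌋ → u ≡ v
≟-sound = toWitness

reach→path : ∀ {n} (es : List (BSub n)) k u v → T (reachB es k u v) → Path es u v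
reach→path es zero u v h rewrite ≟-sound h = here
reach→path es (suc k) u v h with T-∨⁻ {reachB es k u v} h
... | inj₁ r = reach→path es k u v r
... | inj₂ r with anyFin-elim _ r
...   | w , t = path-snoc (reach→path es k u w (T-∧⁻ˡ t)) (T-∧⁻ʳ {reachB es k u w} t)

reach-mono : ∀ {n} (es : List (BSub n)) d k u v → T (reachB es k u v) → T (reachB es (d ℕ.+ k) u v)
reach-mono es zero k u v h = h
reach-mono es (suc d) k u v h = T-∨⁺ˡ (reach-mono es d k u v h)

reach-trans : ∀ {n} (es : List (BSub n)) a b u w v → T (reachB es a u w) → T (reachB es b w v) → T (reachB es (b ℕ.+ a) u v)
reach-trans es a zero u w v h1 h2 rewrite ≟-sound h2 = h1
reach-trans es a (suc b) u w v h1 h2 with T-∨⁻ {reachB es b w v} h2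
... | inj₁ r = T-∨⁺ˡ (reach-trans es a b u w v h1 r)
... | inj₂ r with anyFin-elim _ r
...   | x , t = T-∨⁺ʳ {reachB es (b ℕ.+ a) u v}
                  (anyFin-intro _ x (T-∧⁺ (reach-trans es a b u w x h1 (T-∧⁻ˡ t)) (T-∧⁻ʳ {reachB es b w x} t)))

path→reach : ∀ {n} (es : List (BSub n)) {u v} → Path es u v → Σ ℕ λ k → T (reachB es k u v)
path→reach es {u} here = zero , ≟-refl u
path→reach es {u} (step {w = w} a p) with path→reach es p
... | k , r = k ℕ.+ 1 , reach-trans es 1 k u w _ (T-∨⁺ʳ {⌊ u ≟ w ⌋} (anyFin-intro _ u (T-∧⁺ (≟-refl u) a))) r

-- The sets reachable from u in k steps grow strictly until they stabilise, and
-- they live in Fin n; hence n steps reach everything, i.e. connB is reachability.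
module Reach {n} (es : List (BSub n)) (u : Fin n) where
  r : ℕ → Fin n → Bool
  r k = reachB es k u

  reach-suc-cong : ∀ a b → (∀ v → r a v ≡ r b v) → ∀ v → r (suc a) v ≡ r (suc b) v
  reach-suc-cong a b h v = cong₂ _∨_ (h v) (anyFin-cong λ w → cong (_∧ adjB es w v) (h w))

  Stable : ℕ → Set
  Stable j = ∀ v → r (suc j) v ≡ r j v

  stable : ∀ j → Stable j → ∀ d v → r (d ℕ.+ j) v ≡ r j v
  stable j s zero v = refl
  stable j s (suc d) v = trans (reach-suc-cong (d ℕ.+ j) j (stable j s d) v) (s v)

  stable-from : ∀ j → Stable j → ∀ k → j ≤ k → ∀ v → r k v ≡ r j v
  stable-from j s k j≤k v = subst (λ q → r q v ≡ r j v) (m∸n+n≡m j≤k) (stable j s (k ∸ j) v)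

  grows-or-stabilises : ∀ k → (Σ ℕ λ j → j ≤ k × Stable j) ⊎ (suc k ≤ countFin (r k))
  grows-or-stabilises zero = inj₂ (countFin-pos (r 0) u (≟-refl u))
  grows-or-stabilises (suc k) with grows-or-stabilises k
  ... | inj₁ (j , j≤k , s) = inj₁ (j , ≤-trans j≤k (n≤1+n k) , s)
  ... | inj₂ c with anyFin (λ v → r (suc k) v ∧ not (r k v)) in eq
  ...   | true with anyFin-elim _ (subst T (sym eq) tt)
  ...     | v , t = inj₂ (≤-trans (s≤s c) (countFin-strict (r k) (r (suc k)) (λ w x → T-∨⁺ˡ x) v (T-∧⁻ˡ t) (T-not⁻ (T-∧⁻ʳ {r (suc k) v} t))))
  grows-or-stabilises (suc k) | inj₂ c | false = inj₁ (k , n≤1+n k , λ v → T-ext (λ x → h v x) T-∨⁺ˡ)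
    where
    h : ∀ v → T (r (suc k) v) → T (r k v)
    h v x with T-dec (r k v)
    ... | inj₁ y = y
    ... | inj₂ ny = ⊥-elim (subst T eq (anyFin-intro (λ v → r (suc k) v ∧ not (r k v)) v (T-∧⁺ x (T-not⁺ ny))))

  stabilises : Σ ℕ λ j → j ≤ n × Stable j
  stabilises with grows-or-stabilises n
  ... | inj₁ x = x
  ... | inj₂ c = ⊥-elim (ℕP.<-irrefl refl (ℕP.<-≤-trans c (countFin-≤ (r n))))

  reach→conn : ∀ k v → T (r k v) → T (r n v)
  reach→conn k v h with stabilises
  ... | j , j≤n , s = subst T (trans (stable-from j s (n ℕ.+ k) (≤-trans j≤n (m≤m+n n k)) v) (sym (stable-from j s n j≤n v)))
                               (reach-mono es n k u v h)

path→conn : ∀ {n} (es : List (BSub n)) {u v} → Path es u v → T (connB es u v)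
path→conn es {u} {v} p with path→reach es p
... | k , h = Reach.reach→conn es u k v h

conn→path : ∀ {n} (es : List (BSub n)) u v → T (connB es u v) → Path es u v
conn→path {n} es u v h = reach→path es n u v h

conn-refl : ∀ {n} (es : List (BSub n)) u → T (connB es u u)
conn-refl es u = path→conn es here

conn-sym : ∀ {n} (es : List (BSub n)) u v → T (connB es u v) → T (connB es v u)
conn-sym es u v h = path→conn es (path-rev (conn→path es u v h))

conn-trans : ∀ {n} (es : List (BSub n)) u w v → T (connB es u w) → T (connB es w v) → T (connB es u v)
conn-trans es u w v h1 h2 = path→conn es (path-++ (conn→path es u w h1) (conn→path es w v h2))

-- Counting components

record IsBoolEquivalence {a} {A : Set a} (C : A → A → Bool) : Set a where
  field
    reflB : ∀ x → T (C x x)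
    symB : ∀ x y → T (C x y) → T (C y x)
    transB : ∀ x y z → T (C x y) → T (C y z) → T (C x z)

-- Each class is counted at its last occurrence in the list.
classCount : ∀ {a} {A : Set a} → (A → A → Bool) → List A → ℕ
classCount C [] = 0
classCount C (v ∷ L) = if any (C v) L then classCount C L else suc (classCount C L)

any-cong-∈ : ∀ {a} {A : Set a} {p q : A → Bool} (L : List A) → (∀ x → x ∈ L → p x ≡ q x) → any p L ≡ any q L
any-cong-∈ [] h = refl
any-cong-∈ (x ∷ L) h = cong₂ _∨_ (h x (here refl)) (any-cong-∈ L (λ y m → h y (there m)))

filterB-keepAll : ∀ {a} {A : Set a} (q : A → Bool) (L : List A) → (∀ x → x ∈ L → T (q x)) → filterB q L ≡ L
filterB-keepAll q [] h = refl
filterB-keepAll q (x ∷ L) h with q x in e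
... | true = cong (x ∷_) (filterB-keepAll q L (λ y m → h y (there m)))
... | false = ⊥-elim (subst T e (h x (here refl)))

filterB-keepNone : ∀ {a} {A : Set a} (q : A → Bool) (L : List A) → (∀ x → x ∈ L → T (q x) → ⊥) → filterB q L ≡ []
filterB-keepNone q [] h = refl
filterB-keepNone q (x ∷ L) h with q x in e
... | true = ⊥-elim (h x (here refl) (subst T (sym e) tt))
... | false = filterB-keepNone q L (λ y m → h y (there m))

length-filterB : ∀ {a} {A : Set a} (q : A → Bool) (L : List A) → length (filterB q L) ≤ length L
length-filterB q [] = z≤n
length-filterB q (x ∷ L) with q x
... | true = s≤s (length-filterB q L)
... | false = ≤-trans (length-filterB q L) (n≤1+n _)

module ClassCount {a} {A : Set a} (C : A → A → Bool) (E : IsBoolEquivalence C) where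
  open IsBoolEquivalence E

  apart : A → A → Bool
  apart v w = not (C v w)

  classCount-removeClass : ∀ v L → T (any (C v) L) → classCount C L ≡ suc (classCount C (filterB (apart v) L))
  classCount-removeClass v (x ∷ L0) h with T-dec (C v x)
  classCount-removeClass v (x ∷ L0) h | inj₁ cvx rewrite T⇒≡true cvx with any (C x) L0 in ex
  ... | true = classCount-removeClass v L0 (let (w , m , t) = any-elim (C x) L0 (subst T (sym ex) tt) in any-intro (C v) m (transB v x w cvx t))
  ... | false = cong (λ Z → suc (classCount C Z)) (sym (filterB-keepAll (apart v) L0 λ w m → T-not⁺ λ cvw → subst T ex (any-intro (C x) m (transB x v w (symB v x cvx) cvw))))
  classCount-removeClass v (x ∷ L0) h | inj₂ ncvx rewrite ¬T⇒≡false ncvx = goal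
    where
    hv : T (any (C v) L0)
    hv = h
    eqa : any (C x) (filterB (apart v) L0) ≡ any (C x) L0
    eqa = trans (any-filterB (C x) (apart v) L0) (any-cong-∈ L0 λ w m → T-ext T-∧⁻ʳ
            (λ cxw → T-∧⁺ (T-not⁺ (λ cvw → ncvx (transB v w x cvw (symB x w cxw)))) cxw))
    goal : (if any (C x) L0 then classCount C L0 else suc (classCount C L0)) ≡
           suc (if any (C x) (filterB (apart v) L0) then classCount C (filterB (apart v) L0) else suc (classCount C (filterB (apart v) L0)))
    goal rewrite eqa | classCount-removeClass v L0 hv with any (C x) L0
    ... | true = refl
    ... | false = refl

  Covers : List A → List A → Set a
  Covers L L' = ∀ x → x ∈ L → T (any (C x) L')

  -- The bound k makes the recursion structural, as L shrinks by filtering.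
  classCount-sameClasses-bounded : ∀ k L L' → length L ≤ k → Covers L L' → Covers L' L → classCount C L ≡ classCount C L'
  classCount-sameClasses-bounded k [] [] _ _ _ = refl
  classCount-sameClasses-bounded k [] (y ∷ L') _ s1 s2 = ⊥-elim (s2 y (here refl))
  classCount-sameClasses-bounded (suc k) (v ∷ L0) L' (s≤s len) s1 s2 =
    trans (classCount-removeClass v (v ∷ L0) (T-∨⁺ˡ (reflB v)))
      (trans (cong suc (classCount-sameClasses-bounded k F F' lenF s1' s2'))
        (sym (classCount-removeClass v L' (s1 v (here refl)))))
    where
    F = filterB (apart v) (v ∷ L0)
    F' = filterB (apart v) L'
    eqF : F ≡ filterB (apart v) L0
    eqF rewrite T⇒≡true (reflB v) = refl
    lenF : length F ≤ k
    lenF rewrite eqF = ≤-trans (length-filterB (apart v) L0) len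
    s1' : Covers F F'
    s1' x m with ∈-filterB⁻ (apart v) (v ∷ L0) m
    ... | mx , nvx with any-elim (C x) L' (s1 x mx)
    ...   | y , my , cxy = any-intro (C x) (∈-filterB (apart v) L' my (T-not⁺ λ cvy → T-not⁻ nvx (transB v y x cvy (symB x y cxy)))) cxy
    s2' : Covers F' F
    s2' x m with ∈-filterB⁻ (apart v) L' m
    ... | mx , nvx with any-elim (C x) (v ∷ L0) (s2 x mx)
    ...   | y , my , cxy = any-intro (C x) (∈-filterB (apart v) (v ∷ L0) my (T-not⁺ λ cvy → T-not⁻ nvx (transB v y x cvy (symB x y cxy)))) cxy

  classCount-sameClasses : ∀ L L' → Covers L L' → Covers L' L → classCount C L ≡ classCount C L'
  classCount-sameClasses L L' = classCount-sameClasses-bounded (length L) L L' ≤-refl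

  classCount-oneClass : ∀ v L → v ∈ L → (∀ x → x ∈ L → T (C v x)) → classCount C L ≡ 1
  classCount-oneClass v L m h = trans (classCount-removeClass v L (any-intro (C v) m (reflB v)))
                       (cong (suc ∘ classCount C) (filterB-keepNone (apart v) L λ x mx t → T-not⁻ t (h x mx)))

  module _ (P : A → Bool) (cl : ∀ x y → T (C x y) → P x ≡ P y) where
    any-filterB-outside : ∀ v L → P v ≡ false → any (C v) (filterB (not ∘ P) L) ≡ any (C v) L
    any-filterB-outside v L ep = trans (any-filterB (C v) (not ∘ P) L) (any-cong-∈ L λ w m → T-ext T-∧⁻ʳ λ t → T-∧⁺ (subst (T ∘ not) (trans (sym ep) (cl v w t)) tt) t)
    any-filterB-inside : ∀ v L → P v ≡ true → any (C v) (filterB P L) ≡ any (C v) L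
    any-filterB-inside v L ep = trans (any-filterB (C v) P L) (any-cong-∈ L λ w m → T-ext T-∧⁻ʳ λ t → T-∧⁺ (subst T (trans (sym ep) (cl v w t)) tt) t)

  classCount-split : (P : A → Bool) → (∀ x y → T (C x y) → P x ≡ P y) → ∀ L →
    classCount C L ≡ classCount C (filterB P L) ℕ.+ classCount C (filterB (not ∘ P) L)
  classCount-split P cl [] = refl
  classCount-split P cl (v ∷ L) with P v in ep
  ... | true rewrite any-filterB-inside P cl v L ep | classCount-split P cl L with any (C v) L
  ...   | true = refl
  ...   | false = refl
  classCount-split P cl (v ∷ L) | false rewrite any-filterB-outside P cl v L ep | classCount-split P cl L with any (C v) L
  ...   | true = refl
  ...   | false = sym (+-suc _ _)

classCount≤length : ∀ {a} {A : Set a} (C : A → A → Bool) L → classCount C L ≤ length L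
classCount≤length C [] = z≤n
classCount≤length C (v ∷ L) with any (C v) L
... | true = ≤-trans (classCount≤length C L) (n≤1+n _)
... | false = s≤s (classCount≤length C L)

classCount-++-≥ : ∀ {a} {A : Set a} (C : A → A → Bool) L M → classCount C M ≤ classCount C (L ++ M)
classCount-++-≥ C [] M = ≤-refl
classCount-++-≥ C (v ∷ L) M with any (C v) (L ++ M)
... | true = classCount-++-≥ C L M
... | false = ≤-trans (classCount-++-≥ C L M) (n≤1+n _)

classCount-map : ∀ {a b} {A : Set a} {B : Set b} (C : A → A → Bool) (C' : B → B → Bool) (φ : A → B) L →
  (∀ x y → x ∈ L → y ∈ L → C' (φ x) (φ y) ≡ C x y) → classCount C' (map φ L) ≡ classCount C L
classCount-map C C' φ [] h = refl
classCount-map C C' φ (v ∷ L) h rewrite any-map (C' (φ v)) φ L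
  | any-cong-∈ {p = C' (φ v) ∘ φ} {q = C v} L (λ y m → h v y (here refl) (there m))
  | classCount-map C C' φ L (λ x y mx my → h x y (there mx) (there my)) = refl

minimalCount : ∀ {n} → BSub n → (Fin n → Fin n → Bool) → ℕ
minimalCount W C = countFin (λ v → W v ∧ not (anyFin (λ u → W u ∧ (toℕ u <ᵇ toℕ v) ∧ C u v)))

anyFin-suc : ∀ {n} (p : Fin (suc n) → Bool) → anyFin p ≡ p zero ∨ anyFin (p ∘ suc)
anyFin-suc {n} p = cong (p zero ∨_) (trans (cong or (map-tabulate suc p)) (sym (cong or (map-tabulate id (p ∘ suc)))))

anyFin-false : ∀ n → anyFin {n} (λ _ → false) ≡ false
anyFin-false zero = refl
anyFin-false (suc n) = trans (anyFin-suc {n} (λ _ → false)) (anyFin-false n)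

restrictSuc : ∀ {n} → (Fin (suc n) → Fin (suc n) → Bool) → Fin n → Fin n → Bool
restrictSuc C a b = C (suc a) (suc b)

restrictSuc-isBoolEquivalence : ∀ {n} {C : Fin (suc n) → Fin (suc n) → Bool} → IsBoolEquivalence C → IsBoolEquivalence (restrictSuc C)
restrictSuc-isBoolEquivalence E = record { reflB = λ x → reflB (suc x) ; symB = λ x y → symB (suc x) (suc y) ; transB = λ x y z → transB (suc x) (suc y) (suc z) }
  where open IsBoolEquivalence E

dropClassOfZero : ∀ {n} → BSub (suc n) → (Fin (suc n) → Fin (suc n) → Bool) → BSub n
dropClassOfZero W C v = W (suc v) ∧ not (W zero ∧ C zero (suc v))

minimalCount-suc : ∀ {n} (W : BSub (suc n)) C → IsBoolEquivalence C →
  minimalCount W C ≡ (if W zero then suc (minimalCount (dropClassOfZero W C) (restrictSuc C)) else minimalCount (dropClassOfZero W C) (restrictSuc C))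
minimalCount-suc {n} W C E = trans (countFin-suc P) (trans (cong (λ b → if b then suc (countFin (P ∘ suc)) else countFin (P ∘ suc)) P0) (cong (λ k → if W zero then suc k else k) (countFin-cong Ps)))
  where
  open IsBoolEquivalence E
  P : Fin (suc n) → Bool
  P v = W v ∧ not (anyFin (λ u → W u ∧ (toℕ u <ᵇ toℕ v) ∧ C u v))
  P0 : P zero ≡ W zero
  P0 = trans (cong (λ b → W zero ∧ not b) (trans (anyFin-cong (λ u → ∧-zeroʳ (W u))) (anyFin-false (suc n)))) (∧-identityʳ (W zero))
  Ps : ∀ v → P (suc v) ≡ (dropClassOfZero W C v ∧ not (anyFin (λ u → dropClassOfZero W C u ∧ (toℕ u <ᵇ toℕ v) ∧ restrictSuc C u v)))
  Ps v rewrite anyFin-suc (λ u → W u ∧ (toℕ u <ᵇ toℕ (suc v)) ∧ C u (suc v)) = T-ext to fro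
    where
    X = anyFin (λ u → W (suc u) ∧ (toℕ u <ᵇ toℕ v) ∧ C (suc u) (suc v))
    Y = anyFin (λ u → dropClassOfZero W C u ∧ (toℕ u <ᵇ toℕ v) ∧ restrictSuc C u v)
    A = W (suc v)
    Bz = W zero ∧ C zero (suc v)
    to : T (A ∧ not (Bz ∨ X)) → T ((A ∧ not Bz) ∧ not Y)
    to h = T-∧⁺ {A ∧ not Bz} (T-∧⁺ {A} hA (T-not⁺ λ a → T-not⁻ hn (T-∨⁺ˡ {Bz} a))) (T-not⁺ noY)
      where
      hA = T-∧⁻ˡ {A} h
      hn = T-∧⁻ʳ {A} h
      noY : T Y → ⊥
      noY y with anyFin-elim (λ u → dropClassOfZero W C u ∧ (toℕ u <ᵇ toℕ v) ∧ restrictSuc C u v) y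
      ... | u , t = T-not⁻ hn (T-∨⁺ʳ {Bz} (anyFin-intro (λ u → W (suc u) ∧ (toℕ u <ᵇ toℕ v) ∧ C (suc u) (suc v)) u
                      (T-∧⁺ {W (suc u)} (T-∧⁻ˡ {W (suc u)} (T-∧⁻ˡ {dropClassOfZero W C u} t)) (T-∧⁻ʳ {dropClassOfZero W C u} t))))
    fro : T ((A ∧ not Bz) ∧ not Y) → T (A ∧ not (Bz ∨ X))
    fro h = T-∧⁺ {A} (T-∧⁻ˡ {A} (T-∧⁻ˡ {A ∧ not Bz} h)) (T-not⁺ λ ax → case (T-∨⁻ {Bz} ax))
      where
      na = T-∧⁻ʳ {A} (T-∧⁻ˡ {A ∧ not Bz} h)
      nY = T-∧⁻ʳ {A ∧ not Bz} h
      case : T Bz ⊎ T X → ⊥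
      case (inj₁ a) = T-not⁻ na a
      case (inj₂ x) with anyFin-elim (λ u → W (suc u) ∧ (toℕ u <ᵇ toℕ v) ∧ C (suc u) (suc v)) x
      ... | u , t with T-dec (W zero ∧ C zero (suc u))
      ...   | inj₁ b = T-not⁻ na (T-∧⁺ {W zero} (T-∧⁻ˡ {W zero} b) (transB zero (suc u) (suc v) (T-∧⁻ʳ {W zero} b) (T-∧⁻ʳ {toℕ u <ᵇ toℕ v} (T-∧⁻ʳ {W (suc u)} t))))
      ...   | inj₂ nb = T-not⁻ nY (anyFin-intro (λ u → dropClassOfZero W C u ∧ (toℕ u <ᵇ toℕ v) ∧ restrictSuc C u v) u (T-∧⁺ {dropClassOfZero W C u} (T-∧⁺ {W (suc u)} (T-∧⁻ˡ {W (suc u)} t) (T-not⁺ nb)) (T-∧⁻ʳ {W (suc u)} t)))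

classCount-sel-suc : ∀ {n} (W : BSub (suc n)) C → IsBoolEquivalence C →
  classCount C (sel W) ≡ (if W zero then suc (classCount (restrictSuc C) (sel (dropClassOfZero W C))) else classCount (restrictSuc C) (sel (dropClassOfZero W C)))
classCount-sel-suc {n} W C E rewrite sel-suc W with T-dec (W zero)
... | inj₁ w0 rewrite T⇒≡true w0 =
  trans (ClassCount.classCount-removeClass C E zero (zero ∷ map suc S) (T-∨⁺ˡ (reflB zero)))
    (cong suc (trans (cong (classCount C) eqF) (trans (classCount-map (restrictSuc C) C suc (filterB (λ v → not (C zero (suc v))) S) (λ _ _ _ _ → refl))
       (cong (classCount (restrictSuc C)) (trans (filterB-filterB (λ v → not (C zero (suc v))) (W ∘ suc) (allFin n)) (sel-cong λ v → refl))))))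
  where
  open IsBoolEquivalence E
  S = sel (W ∘ suc)
  eqF : filterB (ClassCount.apart C E zero) (zero ∷ map suc S) ≡ map suc (filterB (λ v → not (C zero (suc v))) S)
  eqF rewrite T⇒≡true (reflB zero) = filterB-map _ suc S
... | inj₂ nw0 rewrite ¬T⇒≡false nw0 =
  trans (classCount-map (restrictSuc C) C suc (sel (W ∘ suc)) (λ _ _ _ _ → refl)) (cong (classCount (restrictSuc C)) (sel-cong λ v → sym (∧-identityʳ (W (suc v)))))

minimalCount≡classCount : ∀ {n} (W : BSub n) C → IsBoolEquivalence C → minimalCount W C ≡ classCount C (sel W)
minimalCount≡classCount {zero} W C E = refl
minimalCount≡classCount {suc n} W C E rewrite minimalCount-suc W C E | classCount-sel-suc W C E | minimalCount≡classCount (dropClassOfZero W C) (restrictSuc C) (restrictSuc-isBoolEquivalence E) = refl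

connB-isBoolEquivalence : ∀ {n} (es : List (BSub n)) → IsBoolEquivalence (connB es)
connB-isBoolEquivalence es = record { reflB = conn-refl es ; symB = conn-sym es ; transB = conn-trans es }

module ConnClasses {n} (es : List (BSub n)) = ClassCount (connB es) (connB-isBoolEquivalence es)

components≡classCount : ∀ {n} (W : BSub n) es → components W es ≡ classCount (connB es) (sel W)
components≡classCount W es = minimalCount≡classCount W (connB es) (connB-isBoolEquivalence es)

connB-mono : ∀ {n} (es es' : List (BSub n)) → (∀ a b → T (adjB es a b) → T (adjB es' a b)) →
  ∀ u v → T (connB es u v) → T (connB es' u v)
connB-mono es es' h u v c = path→conn es' (path-map id (λ a b t → step (h a b t) here) (conn→path es u v c))

connB-cong : ∀ {n} (es es' : List (BSub n)) → (∀ a b → adjB es a b ≡ adjB es' a b) → ∀ u v → connB es u v ≡ connB es' u v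
connB-cong es es' h u v = T-ext (connB-mono es es' (λ a b → subst T (h a b)) u v) (connB-mono es' es (λ a b → subst T (sym (h a b))) u v)

components-cong : ∀ {n} (W W' : BSub n) (es es' : List (BSub n)) → (∀ v → W v ≡ W' v) → (∀ a b → adjB es a b ≡ adjB es' a b) →
  components W es ≡ components W' es'
components-cong W W' es es' hW hA = countFin-cong λ v → cong₂ _∧_ (hW v) (cong not (anyFin-cong λ u →
  cong₂ _∧_ (hW u) (cong ((toℕ u <ᵇ toℕ v) ∧_) (connB-cong es es' hA u v))))

components-transfer : ∀ {n n'} (W : BSub n) (W' : BSub n') es es' (φ : Fin n → Fin n') →
  (∀ u → T (W u) → T (W' (φ u))) →
  (∀ w → T (W' w) → Σ (Fin n) λ u → T (W u) × T (connB es' (φ u) w)) →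
  (∀ u v → T (W u) → T (W v) → connB es' (φ u) (φ v) ≡ connB es u v) →
  components W es ≡ components W' es'
components-transfer {n} {n'} W W' es es' φ ha hb hc =
  trans (components≡classCount W es) (trans (sym (classCount-map (connB es) (connB es') φ (sel W)
     (λ x y mx my → hc x y (∈-sel⁻ W mx) (∈-sel⁻ W my))))
    (trans (ConnClasses.classCount-sameClasses es' (map φ (sel W)) (sel W') s1 s2) (sym (components≡classCount W' es'))))
  where
  s1 : ConnClasses.Covers es' (map φ (sel W)) (sel W')
  s1 x m with ∈-map⁻ φ m
  ... | u , mu , refl = any-intro (connB es' (φ u)) (∈-sel W' (ha u (∈-sel⁻ W mu))) (conn-refl es' (φ u))
  s2 : ConnClasses.Covers es' (sel W') (map φ (sel W))
  s2 w m with hb w (∈-sel⁻ W' m)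
  ... | u , wu , c = any-intro (connB es' w) (∈-map⁺ φ (∈-sel W wu)) (conn-sym es' (φ u) w c)

components-split : ∀ {n} (W : BSub n) es (P : Fin n → Bool) → (∀ x y → T (connB es x y) → P x ≡ P y) →
  components W es ≡ components (λ v → W v ∧ P v) es ℕ.+ components (λ v → W v ∧ not (P v)) es
components-split {n} W es P cl rewrite components≡classCount W es | components≡classCount (λ v → W v ∧ P v) es | components≡classCount (λ v → W v ∧ not (P v)) es =
  trans (ConnClasses.classCount-split es P cl (sel W))
    (cong₂ ℕ._+_ (cong (classCount (connB es)) (filterB-filterB P W (allFin n)))
                 (cong (classCount (connB es)) (filterB-filterB (not ∘ P) W (allFin n))))

components-connected : ∀ {n} (W : BSub n) es v → T (W v) → (∀ x → T (W x) → T (connB es v x)) → components W es ≡ 1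
components-connected W es v wv h = trans (components≡classCount W es) (ConnClasses.classCount-oneClass es v (sel W) (∈-sel W wv) λ x m → h x (∈-sel⁻ W m))

components-mono : ∀ {n} (W₁ W₂ : BSub n) es → (∀ v → T (W₁ v) → T (W₂ v)) → components W₁ es ≤ components W₂ es
components-mono W₁ W₂ es h rewrite components≡classCount W₁ es | components≡classCount W₂ es =
  ≤-trans (classCount-++-≥ (connB es) (sel W₂) (sel W₁))
    (≤-reflexive (ConnClasses.classCount-sameClasses es (sel W₂ ++ sel W₁) (sel W₂) s1 s2))
  where
  s1 : ConnClasses.Covers es (sel W₂ ++ sel W₁) (sel W₂)
  s1 x m with ∈-++⁻ (sel W₂) m
  ... | inj₁ m2 = any-intro (connB es x) m2 (conn-refl es x)
  ... | inj₂ m1 = any-intro (connB es x) (∈-sel W₂ (h x (∈-sel⁻ W₁ m1))) (conn-refl es x)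
  s2 : ConnClasses.Covers es (sel W₂) (sel W₂ ++ sel W₁)
  s2 x m = any-intro (connB es x) (∈-++⁺ˡ m) (conn-refl es x)

representatives : ∀ {n} (es : List (BSub n)) → All (λ g → Σ (Fin n) λ v → T (g v)) es → List (Fin n)
representatives [] [] = []
representatives (g ∷ es) ((v , _) ∷ ps) = v ∷ representatives es ps

length-representatives : ∀ {n} (es : List (BSub n)) ps → length (representatives es ps) ≡ length es
length-representatives [] [] = refl
length-representatives (g ∷ es) (p ∷ ps) = cong suc (length-representatives es ps)

edgeUnion : ∀ {n} → List (BSub n) → BSub n
edgeUnion es v = any (λ g → g v) es

components≤edgeCount : ∀ {n} (es : List (BSub n)) → All (λ g → Σ (Fin n) λ v → T (g v)) es →
  components (edgeUnion es) es ≤ length es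
components≤edgeCount es ps rewrite components≡classCount (edgeUnion es) es =
  ≤-trans (≤-reflexive (ConnClasses.classCount-sameClasses es (sel (edgeUnion es)) (representatives es ps) s1 s2))
    (≤-trans (classCount≤length (connB es) (representatives es ps)) (≤-reflexive (length-representatives es ps)))
  where
  rep-of : ∀ es' ps' x → T (edgeUnion es' x) → (∀ g → g ∈ es' → g ∈ es) → T (any (connB es x) (representatives es' ps'))
  rep-of (g ∷ es') ((w , gw) ∷ ps') x h sub with T-∨⁻ {g x} h
  ... | inj₁ gx = T-∨⁺ˡ (path→conn es (step (any-intro (λ f → f x ∧ f w) (sub g (here refl)) (T-∧⁺ {g x} gx gw)) here))
  ... | inj₂ r = T-∨⁺ʳ {connB es x w} (rep-of es' ps' x r (λ f m → sub f (there m)))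
  s1 : ConnClasses.Covers es (sel (edgeUnion es)) (representatives es ps)
  s1 x m = rep-of es ps x (∈-sel⁻ (edgeUnion es) m) (λ g m → m)
  rep-in : ∀ es' ps' x → x ∈ representatives es' ps' → T (edgeUnion es' x)
  rep-in (g ∷ es') ((w , gw) ∷ ps') x (here refl) = T-∨⁺ˡ gw
  rep-in (g ∷ es') (p ∷ ps') x (there m) = T-∨⁺ʳ {g x} (rep-in es' ps' x m)
  s2 : ConnClasses.Covers es (representatives es ps) (sel (edgeUnion es))
  s2 x m = any-intro (connB es x) (∈-sel (edgeUnion es) (rep-in es ps x m)) (conn-refl es x)

disjointB⁻ : ∀ {n} {f g : BSub n} → T (disjointB f g) → ∀ v → T (f v) → T (g v) → ⊥
disjointB⁻ {f = f} {g} d v fv gv = T-not⁻ d (anyFin-intro (λ v → f v ∧ g v) v (T-∧⁺ {f v} fv gv))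

disjointB⁺ : ∀ {n} {f g : BSub n} → (∀ v → T (f v) → T (g v) → ⊥) → T (disjointB f g)
disjointB⁺ {f = f} {g} h = T-not⁺ λ t → let (v , fg) = anyFin-elim (λ v → f v ∧ g v) t in h v (T-∧⁻ˡ {f v} fg) (T-∧⁻ʳ {f v} fg)

disjointB-sym : ∀ {n} {g h : BSub n} → T (disjointB g h) → T (disjointB h g)
disjointB-sym {g = g} {h} d = disjointB⁺ {f = h} {g = g} (λ v hv gv → disjointB⁻ {f = g} {g = h} d v gv hv)

disjointB-cong : ∀ {n} {f f' g g' : BSub n} → (∀ v → f v ≡ f' v) → (∀ v → g v ≡ g' v) → disjointB f g ≡ disjointB f' g'
disjointB-cong hf hg = cong not (anyFin-cong λ v → cong₂ _∧_ (hf v) (hg v))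

¬disjointB⁻ : ∀ {n} {f g : BSub n} → T (not (disjointB f g)) → Σ (Fin n) λ v → T (f v) × T (g v)
¬disjointB⁻ {f = f} {g} t with anyFin-elim (λ v → f v ∧ g v) (T-not-not⁻ t)
... | v , fg = v , T-∧⁻ˡ {f v} fg , T-∧⁻ʳ {f v} fg

contractEdge : ∀ {n} → BSub n → BSub n → BSub (suc n)
contractEdge f g zero = not (disjointB g f)
contractEdge f g (suc v) = if disjointB g f then g v else (g v ∧ not (f v))

contractVertices : ∀ {n} → BSub n → BSub n → BSub (suc n)
contractVertices V f zero = true
contractVertices V f (suc v) = V v ∧ not (f v)

contractEdge-suc⁻ : ∀ {n} (f g : BSub n) x → T (contractEdge f g (suc x)) → T (g x)
contractEdge-suc⁻ f g x t with disjointB g f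
... | true = t
... | false = T-∧⁻ˡ {g x} t

contractEdge-suc-∉ : ∀ {n} (f g : BSub n) w → T (contractEdge f g (suc w)) → T (f w) → ⊥
contractEdge-suc-∉ f g w t fw with disjointB g f in d
... | true = disjointB⁻ {f = g} {g = f} (subst T (sym d) tt) w t fw
... | false = T-not⁻ (T-∧⁻ʳ {g w} t) fw

contractEdge-suc⁺ : ∀ {n} (f g : BSub n) w → T (g w) → (T (f w) → ⊥) → T (contractEdge f g (suc w))
contractEdge-suc⁺ f g w gw nfw with disjointB g f
... | true = gw
... | false = T-∧⁺ {g w} gw (T-not⁺ nfw)

contractEdge-zero⁺ : ∀ {n} (f g : BSub n) w → T (g w) → T (f w) → T (contractEdge f g zero)
contractEdge-zero⁺ f g w gw fw = T-not⁺ (λ d → disjointB⁻ {f = g} {g = f} d w gw fw)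

contractEdge-disjoint⁻ : ∀ {n} (f g h : BSub n) → T (disjointB (contractEdge f g) (contractEdge f h)) →
  (T (disjointB g f) ⊎ T (disjointB h f)) × (∀ w → T (g w) → T (h w) → T (f w))
contractEdge-disjoint⁻ f g h d = one , two
  where
  one : T (disjointB g f) ⊎ T (disjointB h f)
  one with T-dec (disjointB g f) | T-dec (disjointB h f)
  ... | inj₁ a | _ = inj₁ a
  ... | inj₂ _ | inj₁ b = inj₂ b
  ... | inj₂ a | inj₂ b = ⊥-elim (disjointB⁻ {f = contractEdge f g} {g = contractEdge f h} d zero (T-not⁺ a) (T-not⁺ b))
  two : ∀ w → T (g w) → T (h w) → T (f w)
  two w gw hw with T-dec (f w)
  ... | inj₁ fw = fw
  ... | inj₂ nfw = ⊥-elim (disjointB⁻ {f = contractEdge f g} {g = contractEdge f h} d (suc w) (contractEdge-suc⁺ f g w gw nfw) (contractEdge-suc⁺ f h w hw nfw))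

contractEdge-disjoint⁺ : ∀ {n} (f g h : BSub n) → (T (disjointB g f) ⊎ T (disjointB h f)) → (∀ w → T (g w) → T (h w) → T (f w)) →
  T (disjointB (contractEdge f g) (contractEdge f h))
contractEdge-disjoint⁺ f g h one two = disjointB⁺ {f = contractEdge f g} {g = contractEdge f h} go
  where
  go : ∀ v → T (contractEdge f g v) → T (contractEdge f h v) → ⊥
  go zero tg th = [ (λ d → T-not⁻ tg d) , (λ d → T-not⁻ th d) ] one
  go (suc w) tg th = contractEdge-suc-∉ f g w tg (two w (contractEdge-suc⁻ f g w tg) (contractEdge-suc⁻ f h w th))

-- Contraction of the edge f: φ sends f to the new vertex zero, and ψ sends zero
-- walk-back to a vertex w0 of f, so both directions preserve connectivity.
module Contract {n} (V f : BSub n) (es : List (BSub n)) (w0 : Fin n) (fw0 : T (f w0)) (fV : ∀ v → T (f v) → T (V v)) where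
  es* : List (BSub (suc n))
  es* = map (contractEdge f) es

  φ : Fin n → Fin (suc n)
  φ v = if f v then zero else suc v

  φ-in-f : ∀ v → T (f v) → φ v ≡ zero
  φ-in-f v t rewrite T⇒≡true t = refl

  φ-outside-f : ∀ v → (T (f v) → ⊥) → φ v ≡ suc v
  φ-outside-f v t rewrite ¬T⇒≡false t = refl

  ψ : Fin (suc n) → Fin n
  ψ zero = w0
  ψ (suc x) = x

  contractEdge-φ : ∀ g a → T (g a) → T (contractEdge f g (φ a))
  contractEdge-φ g a ga with T-dec (f a)
  ... | inj₁ fa rewrite φ-in-f a fa = T-not⁺ (λ d → disjointB⁻ {f = g} {g = f} d a ga fa)
  ... | inj₂ nfa rewrite φ-outside-f a nfa with disjointB g f
  ...   | true = ga
  ...   | false = T-∧⁺ {g a} ga (T-not⁺ nfa)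

  adj-φ : ∀ a b → T (adjB (f ∷ es) a b) → Path es* (φ a) (φ b)
  adj-φ a b t with T-∨⁻ {f a ∧ f b} t
  ... | inj₁ fab rewrite φ-in-f a (T-∧⁻ˡ {f a} fab) | φ-in-f b (T-∧⁻ʳ {f a} fab) = here
  ... | inj₂ r with any-elim (λ g → g a ∧ g b) es r
  ...   | g , m , gab = step (any-intro (λ h → h (φ a) ∧ h (φ b)) (∈-map⁺ (contractEdge f) m)
                          (T-∧⁺ {contractEdge f g (φ a)} (contractEdge-φ g a (T-∧⁻ˡ {g a} gab)) (contractEdge-φ g b (T-∧⁻ʳ {g a} gab)))) here

  step-f : ∀ {a b} → T (f a) → T (f b) → Path (f ∷ es) a b
  step-f {a} {b} fa fb = step (T-∨⁺ˡ (T-∧⁺ {f a} fa fb)) here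

  step-g : ∀ {g a b} → g ∈ es → T (g a) → T (g b) → Path (f ∷ es) a b
  step-g {g} {a} {b} m ga gb = step (T-∨⁺ʳ {f a ∧ f b} (any-intro (λ h → h a ∧ h b) m (T-∧⁺ {g a} ga gb))) here

  walk-to-w0 : ∀ g → g ∈ es → T (contractEdge f g zero) → ∀ b → T (g b) → Path (f ∷ es) w0 b
  walk-to-w0 g m t b gb with ¬disjointB⁻ {f = g} {g = f} t
  ... | w , gw , fw = path-++ (step-f fw0 fw) (step-g m gw gb)

  adjψ : ∀ a b → T (adjB es* a b) → Path (f ∷ es) (ψ a) (ψ b)
  adjψ a b t with any-elim (λ h → h a ∧ h b) es* t
  ... | g* , m* , gab with ∈-map⁻ (contractEdge f) m*
  ...   | g , m , refl = go a b (T-∧⁻ˡ {contractEdge f g a} gab) (T-∧⁻ʳ {contractEdge f g a} gab)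
    where
    go : ∀ a b → T (contractEdge f g a) → T (contractEdge f g b) → Path (f ∷ es) (ψ a) (ψ b)
    go zero zero ta tb = here
    go zero (suc b) ta tb = walk-to-w0 g m ta b (contractEdge-suc⁻ f g b tb)
    go (suc a) zero ta tb = path-rev (walk-to-w0 g m tb a (contractEdge-suc⁻ f g a ta))
    go (suc a) (suc b) ta tb = step-g m (contractEdge-suc⁻ f g a ta) (contractEdge-suc⁻ f g b tb)

  walk-back : ∀ u → Path (f ∷ es) u (ψ (φ u))
  walk-back u with T-dec (f u)
  ... | inj₁ fu rewrite φ-in-f u fu = step-f fu fw0
  ... | inj₂ nfu rewrite φ-outside-f u nfu = here

  connB-φ : ∀ u v → connB es* (φ u) (φ v) ≡ connB (f ∷ es) u v
  connB-φ u v = T-ext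
    (λ c → path→conn (f ∷ es) (path-++ (walk-back u) (path-++ (path-map ψ adjψ (conn→path es* (φ u) (φ v) c)) (path-rev (walk-back v)))))
    (λ c → path→conn es* (path-map φ adj-φ (conn→path (f ∷ es) u v c)))

  components-contract : components V (f ∷ es) ≡ components (contractVertices V f) es*
  components-contract = components-transfer V (contractVertices V f) (f ∷ es) es* φ ha hb (λ u v _ _ → connB-φ u v)
    where
    ha : ∀ u → T (V u) → T (contractVertices V f (φ u))
    ha u vu with T-dec (f u)
    ... | inj₁ fu rewrite φ-in-f u fu = tt
    ... | inj₂ nfu rewrite φ-outside-f u nfu = T-∧⁺ {V u} vu (T-not⁺ nfu)
    hb : ∀ w → T (contractVertices V f w) → Σ (Fin n) λ u → T (V u) × T (connB es* (φ u) w)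
    hb zero t = w0 , fV w0 fw0 , subst (λ z → T (connB es* z zero)) (sym (φ-in-f w0 fw0)) (conn-refl es* zero)
    hb (suc x) t = x , T-∧⁻ˡ {V x} t , subst (λ z → T (connB es* z (suc x))) (sym (φ-outside-f x (T-not⁻ (T-∧⁻ʳ {V x} t)))) (conn-refl es* (suc x))

module Extract {n} (V f : BSub n) (es : List (BSub n)) (w0 : Fin n) (fw0 : T (f w0)) (fV : ∀ v → T (f v) → T (V v))
            (dj : ∀ g → g ∈ es → ∀ v → T (g v) → T (f v) → ⊥) where

  adj-pres : ∀ a b → T (adjB (f ∷ es) a b) → f a ≡ f b
  adj-pres a b t with T-∨⁻ {f a ∧ f b} t
  ... | inj₁ fab = trans (T⇒≡true (T-∧⁻ˡ {f a} fab)) (sym (T⇒≡true (T-∧⁻ʳ {f a} fab)))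
  ... | inj₂ r with any-elim (λ g → g a ∧ g b) es r
  ...   | g , m , gab = trans (¬T⇒≡false (dj g m a (T-∧⁻ˡ {g a} gab))) (sym (¬T⇒≡false (dj g m b (T-∧⁻ʳ {g a} gab))))

  path-pres : ∀ {a b} → Path (f ∷ es) a b → f a ≡ f b
  path-pres here = refl
  path-pres (step t p) = trans (adj-pres _ _ t) (path-pres p)

  path-out : ∀ {a b} → (T (f a) → ⊥) → Path (f ∷ es) a b → Path es a b
  path-out nfa here = here
  path-out {a} nfa (step {w = w} t p) with T-∨⁻ {f a ∧ f w} t
  ... | inj₁ fab = ⊥-elim (nfa (T-∧⁻ˡ {f a} fab))
  ... | inj₂ r with any-elim (λ g → g a ∧ w' g) es r
    where w' : BSub n → Bool
          w' g = g w
  ...   | g , m , gab = step r (path-out (dj g m w (T-∧⁻ʳ {g a} gab)) p)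

  components-extract : components V (f ∷ es) ≡ suc (components (λ v → V v ∧ not (f v)) es)
  components-extract = trans (components-split V (f ∷ es) f (λ x y c → path-pres (conn→path (f ∷ es) x y c)))
    (cong₂ ℕ._+_ (components-connected (λ v → V v ∧ f v) (f ∷ es) w0 (T-∧⁺ {V w0} (fV w0 fw0) fw0)
                    (λ x t → path→conn (f ∷ es) (step (T-∨⁺ˡ (T-∧⁺ {f w0} fw0 (T-∧⁻ʳ {V x} t))) here)))
                 (sym (components-transfer (λ v → V v ∧ not (f v)) (λ v → V v ∧ not (f v)) es (f ∷ es) id (λ u t → t)
                    (λ w t → w , t , conn-refl (f ∷ es) w)
                    (λ u v tu tv → T-ext (λ c → path→conn es (path-out (T-not⁻ (T-∧⁻ʳ {V u} tu)) (conn→path (f ∷ es) u v c)))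
                                         (connB-mono es (f ∷ es) (λ a b t → T-∨⁺ʳ {f a ∧ f b} t) u v)))))

-- Edges disjoint from f are unchanged by contractEdge f, up to the shift suc.
module Shift {n} (f : BSub n) (es : List (BSub n)) (dj : ∀ g → g ∈ es → T (disjointB g f)) where
  es* : List (BSub (suc n))
  es* = map (contractEdge f) es

  contractEdge-zero-∉ : ∀ g → g ∈ es → T (contractEdge f g zero) → ⊥
  contractEdge-zero-∉ g m t = T-not⁻ t (dj g m)

  contractEdge-suc-≡ : ∀ g → g ∈ es → ∀ a → contractEdge f g (suc a) ≡ g a
  contractEdge-suc-≡ g m a rewrite T⇒≡true (dj g m) = refl

  adj-suc : ∀ a b → T (adjB es a b) → Path es* (suc a) (suc b)
  adj-suc a b t with any-elim (λ g → g a ∧ g b) es t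
  ... | g , m , gab = step (any-intro (λ h → h (suc a) ∧ h (suc b)) (∈-map⁺ (contractEdge f) m)
                        (subst₂ (λ u w → T (u ∧ w)) (sym (contractEdge-suc-≡ g m a)) (sym (contractEdge-suc-≡ g m b)) gab)) here

  module Back (u : Fin n) where
    ψ : Fin (suc n) → Fin n
    ψ zero = u
    ψ (suc a) = a
    adj-ψ : ∀ a b → T (adjB es* a b) → Path es (ψ a) (ψ b)
    adj-ψ a b t with any-elim (λ h → h a ∧ h b) es* t
    ... | g* , m* , gab with ∈-map⁻ (contractEdge f) m*
    ...   | g , m , refl = go a b (T-∧⁻ˡ {contractEdge f g a} gab) (T-∧⁻ʳ {contractEdge f g a} gab)
      where
      go : ∀ a b → T (contractEdge f g a) → T (contractEdge f g b) → Path es (ψ a) (ψ b)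
      go zero _ ta _ = ⊥-elim (contractEdge-zero-∉ g m ta)
      go (suc a) zero _ tb = ⊥-elim (contractEdge-zero-∉ g m tb)
      go (suc a) (suc b) ta tb = step (any-intro (λ h → h a ∧ h b) m
                                   (T-∧⁺ {g a} (subst T (contractEdge-suc-≡ g m a) ta) (subst T (contractEdge-suc-≡ g m b) tb))) here

  components-shift : components (edgeUnion es) es ≡ components (edgeUnion es*) es*
  components-shift = components-transfer (edgeUnion es) (edgeUnion es*) es es* suc ha hb hc
    where
    ha : ∀ u → T (edgeUnion es u) → T (edgeUnion es* (suc u))
    ha u t with any-elim (λ g → g u) es t
    ... | g , m , gu = any-intro (λ h → h (suc u)) (∈-map⁺ (contractEdge f) m) (subst T (sym (contractEdge-suc-≡ g m u)) gu)
    hb : ∀ w → T (edgeUnion es* w) → Σ (Fin n) λ u → T (edgeUnion es u) × T (connB es* (suc u) w)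
    hb w t with any-elim (λ h → h w) es* t
    ... | g* , m* , gw with ∈-map⁻ (contractEdge f) m*
    hb zero t | g* , m* , gw | g , m , refl = ⊥-elim (contractEdge-zero-∉ g m gw)
    hb (suc a) t | g* , m* , gw | g , m , refl = a , any-intro (λ h → h a) m (subst T (contractEdge-suc-≡ g m a) gw) , conn-refl es* (suc a)
    hc : ∀ u v → T (edgeUnion es u) → T (edgeUnion es v) → connB es* (suc u) (suc v) ≡ connB es u v
    hc u v _ _ = T-ext (λ c → path→conn es (path-map (Back.ψ u) (Back.adj-ψ u) (conn→path es* (suc u) (suc v) c)))
                       (λ c → path→conn es* (path-map suc adj-suc (conn→path es u v c)))

isInj₁ : ∀ {a b} {A : Set a} {B : Set b} → A ⊎ B → Bool
isInj₁ (inj₁ _) = true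
isInj₁ (inj₂ _) = false

module Lift (n1 n2 : ℕ) where
  liftˡ : BSub n1 → BSub (n1 ℕ.+ n2)
  liftˡ g = [ g , (λ _ → false) ] ∘ splitAt n1
  liftʳ : BSub n2 → BSub (n1 ℕ.+ n2)
  liftʳ h = [ (λ _ → false) , h ] ∘ splitAt n1

  liftˡ-↑ˡ : ∀ g u → liftˡ g (u ↑ˡ n2) ≡ g u
  liftˡ-↑ˡ g u rewrite splitAt-↑ˡ n1 u n2 = refl
  liftʳ-↑ʳ : ∀ h u → liftʳ h (n1 ↑ʳ u) ≡ h u
  liftʳ-↑ʳ h u rewrite splitAt-↑ʳ n1 n2 u = refl

  disjointB-liftˡ : ∀ g h → T (disjointB g h) → T (disjointB (liftˡ g) (liftˡ h))
  disjointB-liftˡ g h d = disjointB⁺ {f = liftˡ g} {g = liftˡ h} λ v → go (splitAt n1 v)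
    where go : ∀ s → T ([ g , (λ _ → false) ] s) → T ([ h , (λ _ → false) ] s) → ⊥
          go (inj₁ u) gu hu = disjointB⁻ {f = g} {g = h} d u gu hu
          go (inj₂ _) ()
  disjointB-liftʳ : ∀ g h → T (disjointB g h) → T (disjointB (liftʳ g) (liftʳ h))
  disjointB-liftʳ g h d = disjointB⁺ {f = liftʳ g} {g = liftʳ h} λ v → go (splitAt n1 v)
    where go : ∀ s → T ([ (λ _ → false) , g ] s) → T ([ (λ _ → false) , h ] s) → ⊥
          go (inj₂ u) gu hu = disjointB⁻ {f = g} {g = h} d u gu hu
          go (inj₁ _) ()
  disjointB-liftˡʳ : ∀ g h → T (disjointB (liftˡ g) (liftʳ h))
  disjointB-liftˡʳ g h = disjointB⁺ {f = liftˡ g} {g = liftʳ h} λ v → go (splitAt n1 v)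
    where go : ∀ s → T ([ g , (λ _ → false) ] s) → T ([ (λ _ → false) , h ] s) → ⊥
          go (inj₁ u) _ ()
          go (inj₂ _) ()
  disjointB-liftʳˡ : ∀ g h → T (disjointB (liftʳ g) (liftˡ h))
  disjointB-liftʳˡ g h = disjointB⁺ {f = liftʳ g} {g = liftˡ h} λ v → go (splitAt n1 v)
    where go : ∀ s → T ([ (λ _ → false) , g ] s) → T ([ h , (λ _ → false) ] s) → ⊥
          go (inj₂ u) _ ()
          go (inj₁ _) ()
  disjointB-liftˡ⁻ : ∀ g h → T (disjointB (liftˡ g) (liftˡ h)) → T (disjointB g h)
  disjointB-liftˡ⁻ g h d = disjointB⁺ {f = g} {g = h} λ u gu hu →
    disjointB⁻ {f = liftˡ g} {g = liftˡ h} d (u ↑ˡ n2) (subst T (sym (liftˡ-↑ˡ g u)) gu) (subst T (sym (liftˡ-↑ˡ h u)) hu)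
  disjointB-liftʳ⁻ : ∀ g h → T (disjointB (liftʳ g) (liftʳ h)) → T (disjointB g h)
  disjointB-liftʳ⁻ g h d = disjointB⁺ {f = g} {g = h} λ u gu hu →
    disjointB⁻ {f = liftʳ g} {g = liftʳ h} d (n1 ↑ʳ u) (subst T (sym (liftʳ-↑ʳ g u)) gu) (subst T (sym (liftʳ-↑ʳ h u)) hu)

module Join (n1 n2 : ℕ) (W1 : BSub n1) (W2 : BSub n2) (es1 : List (BSub n1)) (es2 : List (BSub n2)) where
  open Lift n1 n2

  W : BSub (n1 ℕ.+ n2)
  W = [ W1 , W2 ] ∘ splitAt n1
  es : List (BSub (n1 ℕ.+ n2))
  es = map liftˡ es1 ++ map liftʳ es2
  Pl : Fin (n1 ℕ.+ n2) → Bool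
  Pl v = isInj₁ (splitAt n1 v)

  edge-cases : ∀ g → g ∈ es → (Σ (BSub n1) λ g1 → g1 ∈ es1 × g ≡ liftˡ g1) ⊎ (Σ (BSub n2) λ g2 → g2 ∈ es2 × g ≡ liftʳ g2)
  edge-cases g m with ∈-++⁻ (map liftˡ es1) m
  ... | inj₁ m1 = inj₁ (∈-map⁻ liftˡ m1)
  ... | inj₂ m2 = inj₂ (∈-map⁻ liftʳ m2)

  adj-side : ∀ a b → T (adjB es a b) → Pl a ≡ Pl b
  adj-side a b t with any-elim (λ g → g a ∧ g b) es t
  ... | g , m , gab with edge-cases g m
  ...   | inj₁ (g1 , _ , refl) = go (splitAt n1 a) (splitAt n1 b) gab
    where
    go : ∀ (sa sb : Fin n1 ⊎ Fin n2) → T ([ g1 , (λ _ → false) ] sa ∧ [ g1 , (λ _ → false) ] sb) → isInj₁ sa ≡ isInj₁ sb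
    go (inj₁ _) (inj₁ _) _ = refl
    go (inj₁ x) (inj₂ _) t = ⊥-elim (T-∧⁻ʳ {g1 x} t)
    go (inj₂ _) _ ()
  ...   | inj₂ (g2 , _ , refl) = go (splitAt n1 a) (splitAt n1 b) gab
    where
    go : ∀ (sa sb : Fin n1 ⊎ Fin n2) → T ([ (λ _ → false) , g2 ] sa ∧ [ (λ _ → false) , g2 ] sb) → isInj₁ sa ≡ isInj₁ sb
    go (inj₂ _) (inj₂ _) _ = refl
    go (inj₂ x) (inj₁ _) t = ⊥-elim (T-∧⁻ʳ {g2 x} t)
    go (inj₁ _) _ ()

  path-side : ∀ {a b} → Path es a b → Pl a ≡ Pl b
  path-side here = refl
  path-side (step t p) = trans (adj-side _ _ t) (path-side p)

  module Left (u0 : Fin n1) where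
    ψ : Fin (n1 ℕ.+ n2) → Fin n1
    ψ v = [ id , (λ _ → u0) ] (splitAt n1 v)
    ψ-l : ∀ u → ψ (u ↑ˡ n2) ≡ u
    ψ-l u rewrite splitAt-↑ˡ n1 u n2 = refl
    adjψ : ∀ a b → T (adjB es a b) → Path es1 (ψ a) (ψ b)
    adjψ a b t with any-elim (λ g → g a ∧ g b) es t
    ... | g , m , gab with edge-cases g m
    ...   | inj₁ (g1 , m1 , refl) = go (splitAt n1 a) (splitAt n1 b) gab
      where
      go : ∀ (sa sb : Fin n1 ⊎ Fin n2) → T ([ g1 , (λ _ → false) ] sa ∧ [ g1 , (λ _ → false) ] sb) →
           Path es1 ([ id , (λ _ → u0) ] sa) ([ id , (λ _ → u0) ] sb)
      go (inj₁ x) (inj₁ x') t = step (any-intro (λ g → g x ∧ g x') m1 t) here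
      go (inj₁ x) (inj₂ _) t = ⊥-elim (T-∧⁻ʳ {g1 x} t)
      go (inj₂ _) _ ()
    ...   | inj₂ (g2 , m2 , refl) = go (splitAt n1 a) (splitAt n1 b) gab
      where
      go : ∀ (sa sb : Fin n1 ⊎ Fin n2) → T ([ (λ _ → false) , g2 ] sa ∧ [ (λ _ → false) , g2 ] sb) →
           Path es1 ([ id , (λ _ → u0) ] sa) ([ id , (λ _ → u0) ] sb)
      go (inj₂ _) (inj₂ _) _ = here
      go (inj₂ x) (inj₁ _) t = ⊥-elim (T-∧⁻ʳ {g2 x} t)
      go (inj₁ _) _ ()

  module Right (u0 : Fin n2) where
    ψ : Fin (n1 ℕ.+ n2) → Fin n2
    ψ v = [ (λ _ → u0) , id ] (splitAt n1 v)
    ψ-r : ∀ u → ψ (n1 ↑ʳ u) ≡ u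
    ψ-r u rewrite splitAt-↑ʳ n1 n2 u = refl
    adjψ : ∀ a b → T (adjB es a b) → Path es2 (ψ a) (ψ b)
    adjψ a b t with any-elim (λ g → g a ∧ g b) es t
    ... | g , m , gab with edge-cases g m
    ...   | inj₂ (g2 , m2 , refl) = go (splitAt n1 a) (splitAt n1 b) gab
      where
      go : ∀ (sa sb : Fin n1 ⊎ Fin n2) → T ([ (λ _ → false) , g2 ] sa ∧ [ (λ _ → false) , g2 ] sb) →
           Path es2 ([ (λ _ → u0) , id ] sa) ([ (λ _ → u0) , id ] sb)
      go (inj₂ x) (inj₂ x') t = step (any-intro (λ g → g x ∧ g x') m2 t) here
      go (inj₂ x) (inj₁ _) t = ⊥-elim (T-∧⁻ʳ {g2 x} t)
      go (inj₁ _) _ ()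
    ...   | inj₁ (g1 , m1 , refl) = go (splitAt n1 a) (splitAt n1 b) gab
      where
      go : ∀ (sa sb : Fin n1 ⊎ Fin n2) → T ([ g1 , (λ _ → false) ] sa ∧ [ g1 , (λ _ → false) ] sb) →
           Path es2 ([ (λ _ → u0) , id ] sa) ([ (λ _ → u0) , id ] sb)
      go (inj₁ _) (inj₁ _) _ = here
      go (inj₁ x) (inj₂ _) t = ⊥-elim (T-∧⁻ʳ {g1 x} t)
      go (inj₂ _) _ ()

  adjL : ∀ a b → T (adjB es1 a b) → Path es (a ↑ˡ n2) (b ↑ˡ n2)
  adjL a b t with any-elim (λ g → g a ∧ g b) es1 t
  ... | g , m , gab = step (any-intro (λ h → h (a ↑ˡ n2) ∧ h (b ↑ˡ n2)) (∈-++⁺ˡ (∈-map⁺ liftˡ m))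
                        (subst₂ (λ p q → T (p ∧ q)) (sym (liftˡ-↑ˡ g a)) (sym (liftˡ-↑ˡ g b)) gab)) here

  adjR : ∀ a b → T (adjB es2 a b) → Path es (n1 ↑ʳ a) (n1 ↑ʳ b)
  adjR a b t with any-elim (λ g → g a ∧ g b) es2 t
  ... | g , m , gab = step (any-intro (λ h → h (n1 ↑ʳ a) ∧ h (n1 ↑ʳ b)) (∈-++⁺ʳ (map liftˡ es1) (∈-map⁺ liftʳ m))
                        (subst₂ (λ p q → T (p ∧ q)) (sym (liftʳ-↑ʳ g a)) (sym (liftʳ-↑ʳ g b)) gab)) here

  W-l : ∀ u → W (u ↑ˡ n2) ≡ W1 u
  W-l u rewrite splitAt-↑ˡ n1 u n2 = refl
  W-r : ∀ u → W (n1 ↑ʳ u) ≡ W2 u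
  W-r u rewrite splitAt-↑ʳ n1 n2 u = refl
  Pl-l : ∀ u → Pl (u ↑ˡ n2) ≡ true
  Pl-l u rewrite splitAt-↑ˡ n1 u n2 = refl
  Pl-r : ∀ u → Pl (n1 ↑ʳ u) ≡ false
  Pl-r u rewrite splitAt-↑ʳ n1 n2 u = refl

  components-join : components W es ≡ components W1 es1 ℕ.+ components W2 es2
  components-join = trans (components-split W es Pl (λ x y c → path-side (conn→path es x y c)))
    (cong₂ ℕ._+_ (sym (components-transfer W1 (λ v → W v ∧ Pl v) es1 es (_↑ˡ n2) haL hbL hcL))
                 (sym (components-transfer W2 (λ v → W v ∧ not (Pl v)) es2 es (n1 ↑ʳ_) haR hbR hcR)))
    where
    haL : ∀ u → T (W1 u) → T (W (u ↑ˡ n2) ∧ Pl (u ↑ˡ n2))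
    haL u t rewrite W-l u | Pl-l u = T-∧⁺ {W1 u} t tt
    hbL : ∀ w → T (W w ∧ Pl w) → Σ (Fin n1) λ u → T (W1 u) × T (connB es (u ↑ˡ n2) w)
    hbL w t with splitAt-view n1 w
    ... | inj₁ (u , refl) = u , subst T (W-l u) (T-∧⁻ˡ {W (u ↑ˡ n2)} t) , conn-refl es _
    ... | inj₂ (u , refl) = ⊥-elim (subst T (Pl-r u) (T-∧⁻ʳ {W (n1 ↑ʳ u)} t))
    hcL : ∀ u v → T (W1 u) → T (W1 v) → connB es (u ↑ˡ n2) (v ↑ˡ n2) ≡ connB es1 u v
    hcL u v _ _ = T-ext
      (λ c → path→conn es1 (subst₂ (Path es1) (Left.ψ-l u u) (Left.ψ-l u v) (path-map (Left.ψ u) (Left.adjψ u) (conn→path es _ _ c))))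
      (λ c → path→conn es (path-map (_↑ˡ n2) adjL (conn→path es1 u v c)))
    haR : ∀ u → T (W2 u) → T (W (n1 ↑ʳ u) ∧ not (Pl (n1 ↑ʳ u)))
    haR u t rewrite W-r u | Pl-r u = T-∧⁺ {W2 u} t tt
    hbR : ∀ w → T (W w ∧ not (Pl w)) → Σ (Fin n2) λ u → T (W2 u) × T (connB es (n1 ↑ʳ u) w)
    hbR w t with splitAt-view n1 w
    ... | inj₂ (u , refl) = u , subst T (W-r u) (T-∧⁻ˡ {W (n1 ↑ʳ u)} t) , conn-refl es _
    ... | inj₁ (u , refl) = ⊥-elim (T-not⁻ (T-∧⁻ʳ {W (u ↑ˡ n2)} t) (subst T (sym (Pl-l u)) tt))
    hcR : ∀ u v → T (W2 u) → T (W2 v) → connB es (n1 ↑ʳ u) (n1 ↑ʳ v) ≡ connB es2 u v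
    hcR u v _ _ = T-ext
      (λ c → path→conn es2 (subst₂ (Path es2) (Right.ψ-r u u) (Right.ψ-r u v) (path-map (Right.ψ u) (Right.adjψ u) (conn→path es _ _ c))))
      (λ c → path→conn es (path-map (n1 ↑ʳ_) adjR (conn→path es2 u v c)))

allFin?-suc : ∀ {n} (p : Fin (suc n) → Bool) → allFin? p ≡ (p zero ∧ allFin? (p ∘ suc))
allFin?-suc {n} p = cong (p zero ∧_) (trans (cong and (map-tabulate suc p)) (sym (cong and (map-tabulate id (p ∘ suc)))))

-- Labellings

isOut : Lbl → Bool
isOut out = true
isOut _ = false

isOut⇒≡out : ∀ l → T (isOut l) → l ≡ out
isOut⇒≡out out _ = refl

isB⇒≡inB : ∀ l → T (isB l) → l ≡ inB
isB⇒≡inB inB _ = refl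

isAB⇒≢out : ∀ l → T (isAB l) → ¬ (l ≡ out)
isAB⇒≢out inA _ ()
isAB⇒≢out inB _ ()

inA⇒≢out : ∀ {l} → l ≡ inA → ¬ (l ≡ out)
inA⇒≢out refl ()

inB⇒≢out : ∀ {l} → l ≡ inB → ¬ (l ≡ out)
inB⇒≢out refl ()

labelledWithin : ∀ {m} → (Fin m → Bool) → (Fin m → Lbl) → Bool
labelledWithin q σ = allFin? (λ j → q j ∨ isOut (σ j))

relabel : ∀ {m} → (Fin m → Lbl) → Fin m → Lbl → Fin m → Lbl
relabel σ i l j = if ⌊ j ≟ i ⌋ then l else σ j

≟-suc : ∀ {n} (i j : Fin n) → ⌊ suc j ≟ suc i ⌋ ≡ ⌊ j ≟ i ⌋
≟-suc i j with j ≟ i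
... | yes p = refl
... | no p = refl

castMap : ∀ {a b} {A : Set a} {B : Set b} (f : A → B) (S : List A) → Fin (length (map f S)) → Fin (length S)
castMap f (x ∷ S) zero = zero
castMap f (x ∷ S) (suc j) = suc (castMap f S j)

lookup-map-castMap : ∀ {a b} {A : Set a} {B : Set b} (f : A → B) (S : List A) j → lookup (map f S) j ≡ f (lookup S (castMap f S j))
lookup-map-castMap f (x ∷ S) zero = refl
lookup-map-castMap f (x ∷ S) (suc j) = lookup-map-castMap f S j

map-lookup-sel-⊆ : ∀ {m} (p q : Fin m → Bool) → (∀ j → T (p j) → T (q j)) → map (lookup (sel q)) (sel (p ∘ lookup (sel q))) ≡ sel p
map-lookup-sel-⊆ {m} p q h = trans (map-lookup-sel p (sel q)) (trans (filterB-filterB p q (allFin m))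
  (sel-cong λ j → T-ext T-∧⁻ʳ λ pj → T-∧⁺ {q j} (h j pj) pj))

isB⇒isAB : ∀ l → T (isB l) → T (isAB l)
isB⇒isAB inB _ = tt

sectionVertices : ∀ {n m} → (Fin m → BSub n) → List (Fin m) → BSub n
sectionVertices e Bs v = any (λ j → e j v) Bs

vertexDisjointOn : ∀ {n m} → List (Fin m) → (Fin m → BSub n) → (Fin m → Lbl) → Bool
vertexDisjointOn L E σ = all (λ a → all (λ b → not (isA (σ a) ∧ isB (σ b)) ∨ disjointB (E a) (E b)) L) L

adjB-map : ∀ {n m} (E : Fin m → BSub n) L a b → adjB (map E L) a b ≡ any (λ j → E j a ∧ E j b) L
adjB-map E L a b = any-map (λ g → g a ∧ g b) E L

all-lookup : ∀ {a} {A : Set a} (g : A → Bool) (L : List A) → all (g ∘ lookup L) (allFin (length L)) ≡ all g L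
all-lookup g L = trans (cong and (map-tabulate id (g ∘ lookup L)))
                   (sym (trans (cong (all g) (sym (tabulate-lookup L))) (cong and (map-tabulate (lookup L) g))))

vertexDisjointOn-reindex : ∀ {n m} (E : Fin m → BSub n) (L : List (Fin m)) (E' : Fin (length L) → BSub n) (σ : Fin m → Lbl) →
  (∀ k v → E' k v ≡ E (lookup L k) v) →
  all (λ a → all (λ b → not (isA (σ (lookup L a)) ∧ isB (σ (lookup L b))) ∨ disjointB (E' a) (E' b)) (allFin (length L))) (allFin (length L))
    ≡ vertexDisjointOn L E σ
vertexDisjointOn-reindex E L E' σ h = trans
  (all-cong (allFin (length L)) λ a → trans
     (all-cong (allFin (length L)) λ b → cong (not (isA (σ (lookup L a)) ∧ isB (σ (lookup L b))) ∨_) (disjointB-cong (h a) (h b)))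
     (all-lookup (λ b → not (isA (σ (lookup L a)) ∧ isB (σ b)) ∨ disjointB (E (lookup L a)) (E b)) L))
  (all-lookup (λ a → all (λ b → not (isA (σ a) ∧ isB (σ b)) ∨ disjointB (E a) (E b)) L) L)
  where
  all-cong : ∀ {a} {A : Set a} {p q : A → Bool} (L : List A) → (∀ x → p x ≡ q x) → all p L ≡ all q L
  all-cong [] h = refl
  all-cong (x ∷ L) h = cong₂ _∧_ (h x) (all-cong L h)

VertexDisjointOn : ∀ {n m} → List (Fin m) → (Fin m → BSub n) → (Fin m → Lbl) → Set
VertexDisjointOn L E σ = ∀ a b → a ∈ L → b ∈ L → σ a ≡ inA → σ b ≡ inB → T (disjointB (E a) (E b))

vertexDisjointOn⁺ : ∀ {n m} L (E : Fin m → BSub n) σ → VertexDisjointOn L E σ → T (vertexDisjointOn L E σ)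
vertexDisjointOn⁺ L E σ h = all-intro _ L λ a ma → all-intro _ L λ b mb → go a b ma mb
  where
  go : ∀ a b → a ∈ L → b ∈ L → T (not (isA (σ a) ∧ isB (σ b)) ∨ disjointB (E a) (E b))
  go a b ma mb with σ a in ea | σ b in eb
  ... | out | _ = tt
  ... | inB | _ = tt
  ... | inA | out = tt
  ... | inA | inA = tt
  ... | inA | inB = h a b ma mb ea eb

vertexDisjointOn⁻ : ∀ {n m} L (E : Fin m → BSub n) σ → T (vertexDisjointOn L E σ) → VertexDisjointOn L E σ
vertexDisjointOn⁻ L E σ t a b ma mb ea eb =
  let u = all-elim _ (all-elim _ t a ma) b mb in go u
  where
  go : T (not (isA (σ a) ∧ isB (σ b)) ∨ disjointB (E a) (E b)) → T (disjointB (E a) (E b))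
  go u rewrite ea | eb = u

module Insert {m} (p p' : Fin m → Bool) (i : Fin m) (pi : p i ≡ false) (p'i : p' i ≡ true)
           (oth : ∀ j → ¬ (j ≡ i) → p' j ≡ p j) where

  any-sel-insert : ∀ (h : Fin m → Bool) → any h (sel p') ≡ (h i ∨ any h (sel p))
  any-sel-insert h = T-ext to fro
    where
    to : T (any h (sel p')) → T (h i ∨ any h (sel p))
    to t with any-elim h (sel p') t
    ... | j , mj , hj with j ≟ i
    ...   | yes refl = T-∨⁺ˡ hj
    ...   | no ne = T-∨⁺ʳ {h i} (any-intro h (∈-sel p (subst T (oth j ne) (∈-sel⁻ p' mj))) hj)
    fro : T (h i ∨ any h (sel p)) → T (any h (sel p'))
    fro t with T-∨⁻ {h i} t
    ... | inj₁ hi = any-intro h (∈-sel p' (subst T (sym p'i) tt)) hi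
    ... | inj₂ r with any-elim h (sel p) r
    ...   | j , mj , hj with j ≟ i
    ...     | yes refl = any-intro h (∈-sel p' (subst T (sym p'i) tt)) hj
    ...     | no ne = any-intro h (∈-sel p' (subst T (sym (oth j ne)) (∈-sel⁻ p mj))) hj

suc≢ : ∀ {k} {i j : Fin k} → ¬ (j ≡ i) → ¬ (_≡_ {A = Fin (suc k)} (suc j) (suc i))
suc≢ ne refl = ne refl

countFin-insert : ∀ {m} (p p' : Fin m → Bool) (i : Fin m) → p i ≡ false → p' i ≡ true → (∀ j → ¬ (j ≡ i) → p' j ≡ p j) →
  countFin p' ≡ suc (countFin p)
countFin-insert {suc k} p p' zero pi p'i oth rewrite countFin-suc p | countFin-suc p' | pi | p'i =
  cong suc (countFin-cong λ j → oth (suc j) λ ())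
countFin-insert {suc k} p p' (suc i) pi p'i oth rewrite countFin-suc p | countFin-suc p' | oth zero (λ ()) with p zero
... | true = cong suc (countFin-insert (p ∘ suc) (p' ∘ suc) i pi p'i (λ j ne → oth (suc j) (suc≢ ne)))
... | false = countFin-insert (p ∘ suc) (p' ∘ suc) i pi p'i (λ j ne → oth (suc j) (suc≢ ne))

relabel-at : ∀ {m} (σ : Fin m → Lbl) i l → relabel σ i l i ≡ l
relabel-at σ i l rewrite T⇒≡true (≟-refl i) = refl

relabel-elsewhere : ∀ {m} (σ : Fin m → Lbl) i l j → ¬ (j ≡ i) → relabel σ i l j ≡ σ j
relabel-elsewhere σ i l j ne rewrite ¬T⇒≡false {⌊ j ≟ i ⌋} (λ t → ne (≟-sound t)) = refl

VertexDisjoint : ∀ {n m} → (Fin m → BSub n) → (Fin m → Lbl) → Set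
VertexDisjoint E σ = ∀ a b → σ a ≡ inA → σ b ≡ inB → T (disjointB (E a) (E b))

vertexDisjoint⇒On : ∀ {n m} L (E : Fin m → BSub n) σ → VertexDisjoint E σ → T (vertexDisjointOn L E σ)
vertexDisjoint⇒On L E σ h = vertexDisjointOn⁺ L E σ (λ a b _ _ → h a b)

vertexDisjointOn⇒ : ∀ {n m} L (E : Fin m → BSub n) σ → (∀ a → ¬ (σ a ≡ out) → a ∈ L) → T (vertexDisjointOn L E σ) → VertexDisjoint E σ
vertexDisjointOn⇒ L E σ hL t a b ea eb = vertexDisjointOn⁻ L E σ t a b (hL a (inA⇒≢out ea)) (hL b (inB⇒≢out eb)) ea eb

vdPair⇒ : (H : Hypergraph) (σ : Fin (m H) → Lbl) → T (vdPair H σ) → VertexDisjoint (e H) σ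
vdPair⇒ H σ = vertexDisjointOn⇒ (allFin (m H)) (e H) σ (λ a _ → ∈-allFin a)

⇒vdPair : (H : Hypergraph) (σ : Fin (m H) → Lbl) → VertexDisjoint (e H) σ → T (vdPair H σ)
⇒vdPair H σ = vertexDisjoint⇒On (allFin (m H)) (e H) σ

sectionVertices≡edgeUnion : ∀ {n m} (E : Fin m → BSub n) Bs v → sectionVertices E Bs v ≡ edgeUnion (map E Bs) v
sectionVertices≡edgeUnion E Bs v = sym (any-map (λ g → g v) E Bs)

components-section≤edgeCount : ∀ {n m} (E : Fin m → BSub n) (Bs : List (Fin m)) →
  All (λ g → Σ (Fin n) λ v → T (g v)) (map E Bs) → components (sectionVertices E Bs) (map E Bs) ≤ length Bs
components-section≤edgeCount E Bs nonempty =
  ≤-trans (≤-reflexive (components-cong _ _ _ _ (sectionVertices≡edgeUnion E Bs) (λ _ _ → refl)))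
    (≤-trans (components≤edgeCount (map E Bs) nonempty) (≤-reflexive (length-map E Bs)))

-- These bounds make the truncated subtractions in the exponents of ξ exact,
-- so that the exponents add up over a disjoint union.
module SectionBounds (G : Hypergraph) (wf : WellFormed G) (σ : Fin (m G) → Lbl) where
  AB = sel (isAB ∘ σ)
  Bs = sel (isB ∘ σ)
  WB' = sectionVertices (e G) Bs

  edges-nonempty : ∀ L → All (λ g → Σ (Fin (n G)) λ v → T (g v)) (map (e G) L)
  edges-nonempty [] = []
  edges-nonempty (j ∷ L) = proj₂ wf j ∷ edges-nonempty L

  components-section≤length : components WB' (map (e G) Bs) ≤ length AB
  components-section≤length = ≤-trans (components-section≤edgeCount (e G) Bs (edges-nonempty Bs))
                                      (countFin-mono (isB ∘ σ) (isAB ∘ σ) (λ j → isB⇒isAB (σ j)))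

  components-section≤components : T (vdPair G σ) → components WB' (map (e G) Bs) ≤ components (V G) (map (e G) AB)
  components-section≤components tv = ≤-trans (≤-reflexive (components-transfer WB' WB' (map (e G) Bs) (map (e G) AB) id (λ u t → t)
                   (λ w t → w , t , conn-refl _ w) hc))
                (components-mono WB' (V G) (map (e G) AB) sub)
    where
    VD = vdPair⇒ G σ tv
    sub : ∀ v → T (WB' v) → T (V G v)
    sub v t = let (j , _ , ej) = any-elim (λ j → e G j v) Bs t in proj₁ wf j v ej
    incl : ∀ a b → T (adjB (map (e G) Bs) a b) → T (adjB (map (e G) AB) a b)
    incl a b t with any-elim (λ g → g a ∧ g b) (map (e G) Bs) t
    ... | g , mg , gab with ∈-map⁻ (e G) mg
    ...   | j , mj , refl = any-intro (λ g → g a ∧ g b) (∈-map⁺ (e G) (∈-sel (isAB ∘ σ) (isB⇒isAB (σ j) (∈-sel⁻ (isB ∘ σ) mj)))) gab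
    pathB : ∀ {a b} → T (WB' a) → Path (map (e G) AB) a b → Path (map (e G) Bs) a b
    pathB wa here = here
    pathB {a} wa (step {w = w} t p) with any-elim (λ g → g a ∧ g w) (map (e G) AB) t
    ... | g , mg , gaw with ∈-map⁻ (e G) mg
    ...   | j , mj , refl with σ j in ej
    ...     | inB = step (any-intro (λ g → g a ∧ g w) (∈-map⁺ (e G) mjB) gaw)
                        (pathB (any-intro (λ j → e G j w) mjB (T-∧⁻ʳ {e G j a} gaw)) p)
      where mjB = ∈-sel (isB ∘ σ) (subst (T ∘ isB) (sym ej) tt)
    ...     | inA = let (b , mb , eb) = any-elim (λ j → e G j a) Bs wa in
                    ⊥-elim (disjointB⁻ {f = e G j} {g = e G b} (VD j b ej (isB⇒≡inB (σ b) (∈-sel⁻ (isB ∘ σ) mb))) a (T-∧⁻ˡ {e G j a} gaw) eb)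
    ...     | out = ⊥-elim (subst (T ∘ isAB) ej (∈-sel⁻ (isAB ∘ σ) mj))
    hc : ∀ u v → T (WB' u) → T (WB' v) → connB (map (e G) AB) u v ≡ connB (map (e G) Bs) u v
    hc u v wu _ = T-ext (λ c → path→conn _ (pathB wu (conn→path _ u v c))) (connB-mono _ _ incl u v)

module JoinedLabelling (H1 H2 : Hypergraph) (σ1 : Fin (m H1) → Lbl) (σ2 : Fin (m H2) → Lbl) where
  open Lift (n H1) (n H2)

  n1 = n H1
  n2 = n H2
  m1 = m H1
  m2 = m H2
  H = H1 ⊔ᴴ H2
  e1 = e H1
  e2 = e H2

  e-⊔-↑ˡ : ∀ a v → e H (a ↑ˡ m2) v ≡ liftˡ (e1 a) v
  e-⊔-↑ˡ a v rewrite splitAt-↑ˡ m1 a m2 = refl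
  e-⊔-↑ʳ : ∀ b v → e H (m1 ↑ʳ b) v ≡ liftʳ (e2 b) v
  e-⊔-↑ʳ b v rewrite splitAt-↑ʳ m1 m2 b = refl

  σ = joinLabels m1 σ1 σ2

  vdPair-join : vdPair H σ ≡ (vdPair H1 σ1 ∧ vdPair H2 σ2)
  vdPair-join = T-ext to fro
    where
    to : T (vdPair H σ) → T (vdPair H1 σ1 ∧ vdPair H2 σ2)
    to t = T-∧⁺ {vdPair H1 σ1}
      (⇒vdPair H1 σ1 λ a b ea eb → disjointB-liftˡ⁻ (e1 a) (e1 b)
         (subst T (disjointB-cong (e-⊔-↑ˡ a) (e-⊔-↑ˡ b)) (VD (a ↑ˡ m2) (b ↑ˡ m2) (trans (joinLabels-↑ˡ m1 σ1 σ2 a) ea) (trans (joinLabels-↑ˡ m1 σ1 σ2 b) eb))))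
      (⇒vdPair H2 σ2 λ a b ea eb → disjointB-liftʳ⁻ (e2 a) (e2 b)
         (subst T (disjointB-cong (e-⊔-↑ʳ a) (e-⊔-↑ʳ b)) (VD (m1 ↑ʳ a) (m1 ↑ʳ b) (trans (joinLabels-↑ʳ m1 σ1 σ2 a) ea) (trans (joinLabels-↑ʳ m1 σ1 σ2 b) eb))))
      where VD = vdPair⇒ H σ t
    fro : T (vdPair H1 σ1 ∧ vdPair H2 σ2) → T (vdPair H σ)
    fro t = ⇒vdPair H σ go
      where
      V1 = vdPair⇒ H1 σ1 (T-∧⁻ˡ {vdPair H1 σ1} t)
      V2 = vdPair⇒ H2 σ2 (T-∧⁻ʳ {vdPair H1 σ1} t)
      go : VertexDisjoint (e H) σ
      go a b ea eb with splitAt-view m1 a | splitAt-view m1 b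
      ... | inj₁ (a' , refl) | inj₁ (b' , refl) = subst T (sym (disjointB-cong (e-⊔-↑ˡ a') (e-⊔-↑ˡ b')))
              (disjointB-liftˡ (e1 a') (e1 b') (V1 a' b' (trans (sym (joinLabels-↑ˡ m1 σ1 σ2 a')) ea) (trans (sym (joinLabels-↑ˡ m1 σ1 σ2 b')) eb)))
      ... | inj₁ (a' , refl) | inj₂ (b' , refl) = subst T (sym (disjointB-cong (e-⊔-↑ˡ a') (e-⊔-↑ʳ b'))) (disjointB-liftˡʳ (e1 a') (e2 b'))
      ... | inj₂ (a' , refl) | inj₁ (b' , refl) = subst T (sym (disjointB-cong (e-⊔-↑ʳ a') (e-⊔-↑ˡ b'))) (disjointB-liftʳˡ (e2 a') (e1 b'))
      ... | inj₂ (a' , refl) | inj₂ (b' , refl) = subst T (sym (disjointB-cong (e-⊔-↑ʳ a') (e-⊔-↑ʳ b')))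
              (disjointB-liftʳ (e2 a') (e2 b') (V2 a' b' (trans (sym (joinLabels-↑ʳ m1 σ1 σ2 a')) ea) (trans (sym (joinLabels-↑ʳ m1 σ1 σ2 b')) eb)))

  inl : Fin m1 → Fin (m1 ℕ.+ m2)
  inl = _↑ˡ m2
  inr : Fin m2 → Fin (m1 ℕ.+ m2)
  inr = m1 ↑ʳ_

  sel-joined : ∀ (p : Lbl → Bool) → sel (p ∘ σ) ≡ map inl (sel (p ∘ σ1)) ++ map inr (sel (p ∘ σ2))
  sel-joined p = trans (sel-join m1 (p ∘ σ)) (cong₂ _++_
    (cong (map inl) (sel-cong λ a → cong p (joinLabels-↑ˡ m1 σ1 σ2 a)))
    (cong (map inr) (sel-cong λ a → cong p (joinLabels-↑ʳ m1 σ1 σ2 a))))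

  adjB-joined : ∀ L1 L2 a b → adjB (map (e H) (map inl L1 ++ map inr L2)) a b ≡ adjB (map liftˡ (map e1 L1) ++ map liftʳ (map e2 L2)) a b
  adjB-joined L1 L2 a b =
    trans (adjB-map (e H) (map inl L1 ++ map inr L2) a b)
    (trans (any-++ _ (map inl L1) (map inr L2))
    (trans (cong₂ _∨_
       (trans (any-map _ inl L1) (trans (any-cong-∈ L1 (λ j _ → cong₂ _∧_ (e-⊔-↑ˡ j a) (e-⊔-↑ˡ j b)))
          (sym (trans (any-map (λ g → g a ∧ g b) liftˡ (map e1 L1)) (any-map (λ g → liftˡ g a ∧ liftˡ g b) e1 L1)))))
       (trans (any-map _ inr L2) (trans (any-cong-∈ L2 (λ j _ → cong₂ _∧_ (e-⊔-↑ʳ j a) (e-⊔-↑ʳ j b)))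
          (sym (trans (any-map (λ g → g a ∧ g b) liftʳ (map e2 L2)) (any-map (λ g → liftʳ g a ∧ liftʳ g b) e2 L2))))))
    (sym (any-++ (λ g → g a ∧ g b) (map liftˡ (map e1 L1)) (map liftʳ (map e2 L2))))))

  sectionVertices-joined : ∀ L1 L2 v → sectionVertices (e H) (map inl L1 ++ map inr L2) v ≡ [ sectionVertices e1 L1 , sectionVertices e2 L2 ] (splitAt n1 v)
  sectionVertices-joined L1 L2 v =
    trans (any-++ _ (map inl L1) (map inr L2))
    (trans (cong₂ _∨_ (trans (any-map _ inl L1) (any-cong-∈ L1 (λ j _ → e-⊔-↑ˡ j v)))
                          (trans (any-map _ inr L2) (any-cong-∈ L2 (λ j _ → e-⊔-↑ʳ j v))))
    (go (splitAt n1 v)))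
    where
    go : ∀ s → (any (λ j → [ e1 j , (λ _ → false) ] s) L1 ∨ any (λ j → [ (λ _ → false) , e2 j ] s) L2) ≡ [ sectionVertices e1 L1 , sectionVertices e2 L2 ] s
    go (inj₁ u) rewrite any-false L2 = ∨-identityʳ _
    go (inj₂ u) rewrite any-false L1 = refl

  components-joined : ∀ (W1 : BSub n1) (W2 : BSub n2) L1 L2 W → (∀ v → W v ≡ [ W1 , W2 ] (splitAt n1 v)) →
    components W (map (e H) (map inl L1 ++ map inr L2)) ≡ components W1 (map e1 L1) ℕ.+ components W2 (map e2 L2)
  components-joined W1 W2 L1 L2 W hW = trans (components-cong W _ _ _ hW (adjB-joined L1 L2)) (Join.components-join n1 n2 W1 W2 (map e1 L1) (map e2 L2))

-- Sums over labellings

module Sums {c ℓ} (R : CommutativeRing c ℓ) where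
  open CommutativeRing R hiding (zero) renaming (refl to ≈-refl; sym to ≈-sym; trans to ≈-trans; reflexive to ≈-reflexive)
  open import Relation.Binary.Reasoning.Setoid setoid
  open import Algebra.Properties.CommutativeSemigroup +-commutativeSemigroup using () renaming (interchange to +-interchange)

  Σl : ∀ {a} {A : Set a} → List A → (A → Carrier) → Carrier
  Σl L G = foldr (λ σ acc → G σ + acc) 0# L

  Σlab : (m : ℕ) → ((Fin m → Lbl) → Carrier) → Carrier
  Σlab m G = Σl (labellings m) G

  Extensional : ∀ {m} → ((Fin m → Lbl) → Carrier) → Set _
  Extensional {m} G = ∀ σ τ → (∀ j → σ j ≡ τ j) → G σ ≈ G τ

  Σl-cong : ∀ {a} {A : Set a} (L : List A) {G G' : A → Carrier} → (∀ x → G x ≈ G' x) → Σl L G ≈ Σl L G'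
  Σl-cong [] h = ≈-refl
  Σl-cong (x ∷ L) h = +-cong (h x) (Σl-cong L h)

  Σl-+ : ∀ {a} {A : Set a} (L : List A) (G H : A → Carrier) → Σl L (λ x → G x + H x) ≈ Σl L G + Σl L H
  Σl-+ [] G H = ≈-sym (+-identityˡ 0#)
  Σl-+ (x ∷ L) G H = begin
    (G x + H x) + Σl L (λ x → G x + H x) ≈⟨ +-congˡ (Σl-+ L G H) ⟩
    (G x + H x) + (Σl L G + Σl L H) ≈⟨ +-interchange (G x) (H x) (Σl L G) (Σl L H) ⟩
    (G x + Σl L G) + (H x + Σl L H) ∎

  Σl-* : ∀ {a} {A : Set a} (L : List A) (k : Carrier) (G : A → Carrier) → Σl L (λ x → k * G x) ≈ k * Σl L G
  Σl-* [] k G = ≈-sym (zeroʳ k)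
  Σl-* (x ∷ L) k G = ≈-trans (+-congˡ (Σl-* L k G)) (≈-sym (distribˡ k (G x) (Σl L G)))

  Σl-0 : ∀ {a} {A : Set a} (L : List A) → Σl L (λ _ → 0#) ≈ 0#
  Σl-0 [] = ≈-refl
  Σl-0 (x ∷ L) = ≈-trans (+-identityˡ _) (Σl-0 L)

  Σl-++ : ∀ {a} {A : Set a} (L M : List A) G → Σl (L ++ M) G ≈ Σl L G + Σl M G
  Σl-++ [] M G = ≈-sym (+-identityˡ _)
  Σl-++ (x ∷ L) M G = ≈-trans (+-congˡ (Σl-++ L M G)) (≈-sym (+-assoc _ _ _))

  Σl-concatMap : ∀ {a b} {A : Set a} {B : Set b} (f : A → List B) (L : List A) G →
    Σl (concatMap f L) G ≈ Σl L (λ x → Σl (f x) G)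
  Σl-concatMap f [] G = ≈-refl
  Σl-concatMap f (x ∷ L) G = ≈-trans (Σl-++ (f x) (concatMap f L) G) (+-congˡ (Σl-concatMap f L G))

  Σl-swap : ∀ {a b} {A : Set a} {B : Set b} (L : List A) (M : List B) (G : A → B → Carrier) →
    Σl L (λ x → Σl M (G x)) ≈ Σl M (λ y → Σl L (λ x → G x y))
  Σl-swap [] M G = ≈-sym (Σl-0 M)
  Σl-swap (x ∷ L) M G = ≈-trans (+-congˡ (Σl-swap L M G)) (≈-sym (Σl-+ M (G x) (λ y → Σl L (λ x → G x y))))

  extensions : ∀ {m} → (Fin m → Lbl) → List (Fin (suc m) → Lbl)
  extensions σ = consL out σ ∷ consL inA σ ∷ consL inB σ ∷ []

  Σlab-suc : ∀ m G → Σlab (suc m) G ≈ Σlab m (λ τ → Σl (extensions τ) G)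
  Σlab-suc m G = Σl-concatMap extensions (labellings m) G

  Σ3 : (Lbl → Carrier) → Carrier
  Σ3 g = Σl (out ∷ inA ∷ inB ∷ []) g

  Extensional-consL : ∀ {m} (G : (Fin (suc m) → Lbl) → Carrier) → Extensional G → ∀ l → Extensional (λ τ → G (consL l τ))
  Extensional-consL G eG l σ τ h = eG _ _ λ { zero → refl ; (suc j) → h j }

  Extensional-Σ3 : ∀ {m} (G : (Fin (suc m) → Lbl) → Carrier) → Extensional G → Extensional (λ τ → Σl (extensions τ) G)
  Extensional-Σ3 G eG σ τ h = Σl-cong (out ∷ inA ∷ inB ∷ []) {λ l → G (consL l σ)} {λ l → G (consL l τ)} (λ l → Extensional-consL G eG l σ τ h)

  Σlab-cong : ∀ m {G G'} → (∀ σ → G σ ≈ G' σ) → Σlab m G ≈ Σlab m G'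
  Σlab-cong m h = Σl-cong (labellings m) h

  Σlab-map : ∀ {a b} {A : Set a} {B : Set b} (f : A → B) (S : List A) G → Extensional G →
    Σlab (length (map f S)) G ≈ Σlab (length S) (λ ρ → G (ρ ∘ castMap f S))
  Σlab-map f [] G eG = +-congʳ (eG _ _ λ ())
  Σlab-map f (x ∷ S) G eG = begin
    Σlab (suc (length (map f S))) G ≈⟨ Σlab-suc _ G ⟩
    Σlab (length (map f S)) (λ τ → Σl (extensions τ) G) ≈⟨ Σlab-map f S _ (Extensional-Σ3 G eG) ⟩
    Σlab (length S) (λ ρ → Σl (extensions (ρ ∘ castMap f S)) G) ≈⟨ Σlab-cong (length S) (λ ρ → Σl-cong (out ∷ inA ∷ inB ∷ []) λ l → eG (consL l (ρ ∘ castMap f S)) (consL l ρ ∘ castMap f (x ∷ S)) λ { zero → refl ; (suc j) → refl }) ⟩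
    Σlab (length S) (λ ρ → Σl (extensions ρ) (λ σ → G (σ ∘ castMap f (x ∷ S)))) ≈⟨ ≈-sym (Σlab-suc (length S) (λ σ → G (σ ∘ castMap f (x ∷ S)))) ⟩
    Σlab (suc (length S)) (λ ρ → G (ρ ∘ castMap f (x ∷ S))) ∎

  [_]·_ : Bool → Carrier → Carrier
  [ b ]· x = if b then x else 0#

  []·-cong : ∀ b {x y} → x ≈ y → [ b ]· x ≈ [ b ]· y
  []·-cong true h = h
  []·-cong false h = ≈-refl

  []·-≡ : ∀ {b b'} x → b ≡ b' → [ b ]· x ≈ [ b' ]· x
  []·-≡ x refl = ≈-refl

  []·-* : ∀ b k X → [ b ]· (k * X) ≈ k * ([ b ]· X)
  []·-* true k X = ≈-refl
  []·-* false k X = ≈-sym (zeroʳ k)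

  relabelSum : ∀ {m} → ((Fin m → Lbl) → Carrier) → Fin m → (Fin m → Lbl) → Carrier
  relabelSum G i σ = G σ + (G (relabel σ i inA) + G (relabel σ i inB))

  -- Groups the three labellings that agree off i, indexed by the one with i out.
  outAt : ∀ {m} → ((Fin m → Lbl) → Carrier) → Fin m → (Fin m → Lbl) → Carrier
  outAt G i σ = [ isOut (σ i) ]· relabelSum G i σ

  +-cong₃ : ∀ a b c a' b' c' → a ≈ a' → b ≈ b' → c ≈ c' → a + (b + (c + 0#)) ≈ (a' + (b' + c')) + (0# + (0# + 0#))
  +-cong₃ a b c a' b' c' ha hb hc = begin
    a + (b + (c + 0#)) ≈⟨ +-cong ha (+-cong hb (≈-trans (+-identityʳ c) hc)) ⟩
    a' + (b' + c') ≈⟨ ≈-sym (+-identityʳ _) ⟩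
    (a' + (b' + c')) + 0# ≈⟨ +-congˡ (≈-sym (≈-trans (+-identityˡ _) (+-identityˡ _))) ⟩
    (a' + (b' + c')) + (0# + (0# + 0#)) ∎

  Σlab-outAt : ∀ m (G : (Fin m → Lbl) → Carrier) → Extensional G → ∀ i → Σlab m G ≈ Σlab m (outAt G i)
  Σlab-outAt (suc k) G eG zero = begin
    Σlab (suc k) G ≈⟨ Σlab-suc k G ⟩
    Σlab k (λ τ → Σl (extensions τ) G) ≈⟨ Σlab-cong k (λ τ → +-cong₃ _ _ _ _ _ _ ≈-refl
          (eG _ _ λ { zero → refl ; (suc j) → refl }) (eG _ _ λ { zero → refl ; (suc j) → refl })) ⟩
    Σlab k (λ τ → Σl (extensions τ) (outAt G zero)) ≈⟨ ≈-sym (Σlab-suc k (outAt G zero)) ⟩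
    Σlab (suc k) (outAt G zero) ∎
  Σlab-outAt (suc k) G eG (suc i) = begin
    Σlab (suc k) G ≈⟨ Σlab-suc k G ⟩
    Σlab k (λ τ → Σl (extensions τ) G) ≈⟨ Σl-swap (labellings k) (out ∷ inA ∷ inB ∷ []) (λ τ l → G (consL l τ)) ⟩
    Σ3 (λ l → Σlab k (λ τ → G (consL l τ))) ≈⟨ Σl-cong (out ∷ inA ∷ inB ∷ []) (λ l → Σlab-outAt k (λ τ → G (consL l τ)) (Extensional-consL G eG l) i) ⟩
    Σ3 (λ l → Σlab k (outAt (λ τ → G (consL l τ)) i)) ≈⟨ ≈-sym (Σl-swap (labellings k) (out ∷ inA ∷ inB ∷ []) (λ τ l → outAt (λ τ → G (consL l τ)) i τ)) ⟩
    Σlab k (λ τ → Σ3 (λ l → outAt (λ τ → G (consL l τ)) i τ)) ≈⟨ Σlab-cong k (λ τ → Σl-cong (out ∷ inA ∷ inB ∷ []) λ l →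
          []·-cong (isOut (τ i)) (+-congˡ {G (consL l τ)} (+-cong (eG _ _ (consL-relabel l τ inA)) (eG _ _ (consL-relabel l τ inB))))) ⟩
    Σlab k (λ τ → Σl (extensions τ) (outAt G (suc i))) ≈⟨ ≈-sym (Σlab-suc k (outAt G (suc i))) ⟩
    Σlab (suc k) (outAt G (suc i)) ∎
    where
    consL-relabel : ∀ l τ l' j → consL l (relabel τ i l') j ≡ relabel (consL l τ) (suc i) l' j
    consL-relabel l τ l' zero = refl
    consL-relabel l τ l' (suc j) rewrite ≟-suc i j = refl

  labelledWithin-consL : ∀ {k} (q : Fin (suc k) → Bool) l τ → labelledWithin q (consL l τ) ≡ ((q zero ∨ isOut l) ∧ labelledWithin (q ∘ suc) τ)
  labelledWithin-consL q l τ = allFin?-suc (λ j → q j ∨ isOut (consL l τ j))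

  -- Labellings of the sub-family L of indices are the labellings of all indices
  -- that put every index outside q to out.
  Restricts : ∀ {m} → (Fin m → Bool) → List (Fin m) → Set _
  Restricts {m} q L = ∀ (G : (Fin (length L) → Lbl) → Carrier) → Extensional G →
    Σlab (length L) G ≈ Σlab m (λ σ → [ labelledWithin q σ ]· G (σ ∘ lookup L))

  pad-zeros : ∀ a → a ≈ a + (0# + (0# + 0#))
  pad-zeros a = ≈-sym (≈-trans (+-congˡ (≈-trans (+-identityˡ _) (+-identityˡ _))) (+-identityʳ a))

  Σlab-restrict : ∀ m (q : Fin m → Bool) → Restricts q (sel q)
  Σlab-restrict zero q G eG = +-congʳ (eG _ _ λ ())
  Σlab-restrict (suc k) q = subst (Restricts q) (sym (sel-suc q)) (by-head (q zero) refl)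
    where
    S = sel (q ∘ suc)
    by-head : ∀ b → q zero ≡ b → Restricts q (if b then zero ∷ map suc S else map suc S)
    by-head false e G eG = begin
      Σlab (length (map suc S)) G ≈⟨ Σlab-map suc S G eG ⟩
      Σlab (length S) (λ ρ → G (ρ ∘ castMap suc S)) ≈⟨ Σlab-restrict k (q ∘ suc) _ (λ σ τ h → eG _ _ (λ j → h (castMap suc S j))) ⟩
      Σlab k (λ τ → [ labelledWithin (q ∘ suc) τ ]· G (τ ∘ lookup S ∘ castMap suc S)) ≈⟨ Σlab-cong k (λ τ → restrict-step τ) ⟩
      Σlab k (λ τ → Σl (extensions τ) (λ σ → [ labelledWithin q σ ]· G (σ ∘ lookup (map suc S)))) ≈⟨ ≈-sym (Σlab-suc k _) ⟩
      Σlab (suc k) (λ σ → [ labelledWithin q σ ]· G (σ ∘ lookup (map suc S))) ∎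
      where
      restrict-step : ∀ τ → [ labelledWithin (q ∘ suc) τ ]· G (τ ∘ lookup S ∘ castMap suc S) ≈ Σl (extensions τ) (λ σ → [ labelledWithin q σ ]· G (σ ∘ lookup (map suc S)))
      restrict-step τ rewrite labelledWithin-consL q out τ | labelledWithin-consL q inA τ | labelledWithin-consL q inB τ | e =
        ≈-trans ([]·-cong (labelledWithin (q ∘ suc) τ) (eG _ _ (λ j → cong (consL out τ) (sym (lookup-map-castMap suc S j)))))
              (pad-zeros _)
    by-head true e G eG = begin
      Σlab (suc (length (map suc S))) G ≈⟨ Σlab-suc _ G ⟩
      Σlab (length (map suc S)) (λ τ → Σl (extensions τ) G) ≈⟨ Σlab-map suc S _ (Extensional-Σ3 G eG) ⟩
      Σlab (length S) (λ ρ → Σl (extensions (ρ ∘ castMap suc S)) G) ≈⟨ Σlab-restrict k (q ∘ suc) _ (λ σ τ h → Extensional-Σ3 G eG _ _ (λ j → h (castMap suc S j))) ⟩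
      Σlab k (λ τ → [ labelledWithin (q ∘ suc) τ ]· Σl (extensions (τ ∘ lookup S ∘ castMap suc S)) G) ≈⟨ Σlab-cong k (λ τ → restrict-step τ (labelledWithin (q ∘ suc) τ) refl) ⟩
      Σlab k (λ τ → Σl (extensions τ) (λ σ → [ labelledWithin q σ ]· G (σ ∘ lookup (zero ∷ map suc S)))) ≈⟨ ≈-sym (Σlab-suc k _) ⟩
      Σlab (suc k) (λ σ → [ labelledWithin q σ ]· G (σ ∘ lookup (zero ∷ map suc S))) ∎
      where
      consL-lookup : ∀ τ l j → consL l (τ ∘ lookup S ∘ castMap suc S) j ≡ (consL l τ ∘ lookup (zero ∷ map suc S)) j
      consL-lookup τ l zero = refl
      consL-lookup τ l (suc j) = cong (consL l τ) (sym (lookup-map-castMap suc S j))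
      restrict-step : ∀ τ b → labelledWithin (q ∘ suc) τ ≡ b → [ labelledWithin (q ∘ suc) τ ]· Σl (extensions (τ ∘ lookup S ∘ castMap suc S)) G ≈
                   Σl (extensions τ) (λ σ → [ labelledWithin q σ ]· G (σ ∘ lookup (zero ∷ map suc S)))
      restrict-step τ b eb rewrite labelledWithin-consL q out τ | labelledWithin-consL q inA τ | labelledWithin-consL q inB τ | e | eb with b
      ... | true = +-cong (eG _ _ (consL-lookup τ out)) (+-cong (eG _ _ (consL-lookup τ inA)) (+-cong (eG _ _ (consL-lookup τ inB)) ≈-refl))
      ... | false = ≈-sym (≈-trans (+-identityˡ _) (≈-trans (+-identityˡ _) (+-identityˡ _)))

  Σlab-join : ∀ m1 m2 (G : (Fin (m1 ℕ.+ m2) → Lbl) → Carrier) → Extensional G →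
    Σlab (m1 ℕ.+ m2) G ≈ Σlab m1 (λ σ1 → Σlab m2 (λ σ2 → G (joinLabels m1 σ1 σ2)))
  Σlab-join zero m2 G eG = ≈-sym (+-identityʳ _)
  Σlab-join (suc m1) m2 G eG = begin
    Σlab (suc (m1 ℕ.+ m2)) G ≈⟨ Σlab-suc (m1 ℕ.+ m2) G ⟩
    Σlab (m1 ℕ.+ m2) (λ τ → Σl (extensions τ) G) ≈⟨ Σlab-join m1 m2 _ (Extensional-Σ3 G eG) ⟩
    Σlab m1 (λ σ1 → Σlab m2 (λ σ2 → Σl (extensions (joinLabels m1 σ1 σ2)) G)) ≈⟨ Σlab-cong m1 (λ σ1 → ≈-trans
        (Σlab-cong m2 (λ σ2 → Σl-cong (out ∷ inA ∷ inB ∷ []) (λ l → eG _ _ (consL-joinLabels l σ1 σ2))))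
        (Σl-swap (labellings m2) (out ∷ inA ∷ inB ∷ []) (λ σ2 l → G (joinLabels (suc m1) (consL l σ1) σ2)))) ⟩
    Σlab m1 (λ σ1 → Σl (extensions σ1) (λ σ → Σlab m2 (λ σ2 → G (joinLabels (suc m1) σ σ2)))) ≈⟨ ≈-sym (Σlab-suc m1 _) ⟩
    Σlab (suc m1) (λ σ1 → Σlab m2 (λ σ2 → G (joinLabels (suc m1) σ1 σ2))) ∎
    where
    consL-joinLabels : ∀ l σ1 σ2 j → consL l (joinLabels m1 σ1 σ2) j ≡ joinLabels (suc m1) (consL l σ1) σ2 j
    consL-joinLabels l σ1 σ2 zero = refl
    consL-joinLabels l σ1 σ2 (suc j) with splitAt m1 j
    ... | inj₁ a = refl
    ... | inj₂ b = refl

  pow-+ : ∀ w p q → pow R w (p ℕ.+ q) ≈ pow R w p * pow R w q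
  pow-+ w zero q = ≈-sym (*-identityˡ _)
  pow-+ w (suc p) q = ≈-trans (*-congˡ (pow-+ w p q)) (≈-sym (*-assoc _ _ _))

  weight : ∀ {m} → (Fin m → Carrier) → List (Fin m) → Carrier
  weight t AB = foldr (λ j acc → t j * acc) 1# AB

  weight-++ : ∀ {m} (t : Fin m → Carrier) L M → weight t (L ++ M) ≈ weight t L * weight t M
  weight-++ t [] M = ≈-sym (*-identityˡ _)
  weight-++ t (j ∷ L) M = ≈-trans (*-congˡ (weight-++ t L M)) (≈-sym (*-assoc _ _ _))

  weight-map-cong : ∀ {m k} (t : Fin m → Carrier) (t' : Fin k → Carrier) (f : Fin k → Fin m) L → (∀ a → t (f a) ≡ t' a) →
    weight t (map f L) ≈ weight t' L
  weight-map-cong t t' f [] h = ≈-refl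
  weight-map-cong t t' f (a ∷ L) h = *-cong (≈-reflexive (h a)) (weight-map-cong t t' f L h)

module Polynomial {c ℓ} (R : CommutativeRing c ℓ) (x y z : CommutativeRing.Carrier R) where
  open CommutativeRing R hiding (zero) renaming (refl to ≈-refl; sym to ≈-sym; trans to ≈-trans; reflexive to ≈-reflexive)
  open Sums R
  open import Relation.Binary.Reasoning.Setoid setoid

  summand : ∀ {n m} → BSub n → (Fin m → BSub n) → (Fin m → Carrier) → List (Fin m) → List (Fin m) → Carrier
  summand V e t AB Bs = pow R x (components V (map e AB) ∸ components (sectionVertices e Bs) (map e Bs))
                    * pow R y (length AB ∸ components (sectionVertices e Bs) (map e Bs))
                    * pow R z (components (sectionVertices e Bs) (map e Bs)) * weight t AB

  summand-≡ : ∀ {n m} (V : BSub n) (E : Fin m → BSub n) t AB Bs {a b l Q} →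
    components V (map E AB) ≡ a → components (sectionVertices E Bs) (map E Bs) ≡ b → length AB ≡ l → weight t AB ≡ Q →
    summand V E t AB Bs ≡ pow R x (a ∸ b) * pow R y (l ∸ b) * pow R z b * Q
  summand-≡ V E t AB Bs refl refl refl refl = refl

  ξ-term : (H : Hypergraph) → (Fin (m H) → Carrier) → (Fin (m H) → Lbl) → Carrier
  ξ-term H t σ = [ vdPair H σ ]· summand (V H) (e H) t (sel (isAB ∘ σ)) (sel (isB ∘ σ))

  ξ-term-extensional : ∀ H t → Extensional (ξ-term H t)
  ξ-term-extensional H t σ σ' h = ≈-reflexive (cong₂ (λ b L → [ b ]· L)
      (allFin-cong λ a → allFin-cong λ b → cong₂ (λ u w → not (isA u ∧ isB w) ∨ disjointB (e H a) (e H b)) (h a) (h b))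
      (cong₂ (summand (V H) (e H) t) (sel-cong λ j → cong isAB (h j)) (sel-cong λ j → cong isB (h j))))

  weight-map : ∀ {m k} (t : Fin m → Carrier) (f : Fin k → Fin m) L → weight t (map f L) ≡ weight (t ∘ f) L
  weight-map t f [] = refl
  weight-map t f (j ∷ L) = cong (t (f j) *_) (weight-map t f L)

  summand-reindex : ∀ {n m} (V : BSub n) (E : Fin m → BSub n) (L : List (Fin m)) (E' : Fin (length L) → BSub n) t AB Bs →
    (∀ k v → E' k v ≡ E (lookup L k) v) →
    summand V E' (t ∘ lookup L) AB Bs ≡ summand V E t (map (lookup L) AB) (map (lookup L) Bs)
  summand-reindex V E L E' t AB Bs h =
    trans (summand-≡ V E' (t ∘ lookup L) AB Bs components-AB components-B (sym (length-map (lookup L) AB)) (sym (weight-map t (lookup L) AB)))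
          (sym (summand-≡ V E t (map (lookup L) AB) (map (lookup L) Bs) refl refl refl refl))
    where
    adjB-reindex : ∀ S a b → adjB (map E' S) a b ≡ adjB (map E (map (lookup L) S)) a b
    adjB-reindex S a b = trans (adjB-map E' S a b) (trans (any-cong-∈ S (λ k _ → cong₂ _∧_ (h k a) (h k b)))
                           (sym (trans (adjB-map E (map (lookup L) S) a b) (any-map (λ j → E j a ∧ E j b) (lookup L) S))))
    components-AB : components V (map E' AB) ≡ components V (map E (map (lookup L) AB))
    components-AB = components-cong V V (map E' AB) (map E (map (lookup L) AB)) (λ _ → refl) (adjB-reindex AB)
    components-B : components (sectionVertices E' Bs) (map E' Bs) ≡ components (sectionVertices E (map (lookup L) Bs)) (map E (map (lookup L) Bs))
    components-B = components-cong (sectionVertices E' Bs) (sectionVertices E (map (lookup L) Bs)) (map E' Bs) (map E (map (lookup L) Bs))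
                     (λ v → trans (any-cong-∈ Bs (λ k _ → h k v)) (sym (any-map (λ j → E j v) (lookup L) Bs))) (adjB-reindex Bs)

  weight-sel-suc : ∀ {k} (t : Fin (suc k) → Carrier) (p : Fin (suc k) → Bool) →
    weight t (sel p) ≡ (if p zero then t zero * weight (t ∘ suc) (sel (p ∘ suc)) else weight (t ∘ suc) (sel (p ∘ suc)))
  weight-sel-suc t p rewrite sel-suc p with p zero
  ... | true = cong (t zero *_) (weight-map t suc (sel (p ∘ suc)))
  ... | false = weight-map t suc (sel (p ∘ suc))

  weight-sel-insert : ∀ {m} (t : Fin m → Carrier) (p p' : Fin m → Bool) (i : Fin m) → p i ≡ false → p' i ≡ true → (∀ j → ¬ (j ≡ i) → p' j ≡ p j) →
    weight t (sel p') ≈ t i * weight t (sel p)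
  weight-sel-insert {suc k} t p p' zero pi p'i oth rewrite weight-sel-suc t p | weight-sel-suc t p' | pi | p'i =
    *-congˡ (≈-reflexive (cong (weight (t ∘ suc)) (sel-cong λ j → oth (suc j) λ ())))
  weight-sel-insert {suc k} t p p' (suc i) pi p'i oth rewrite weight-sel-suc t p | weight-sel-suc t p' | oth zero (λ ()) with p zero
  ... | true = ≈-trans (*-congˡ (weight-sel-insert (t ∘ suc) (p ∘ suc) (p' ∘ suc) i pi p'i (λ j ne → oth (suc j) (suc≢ ne))))
                 (≈-trans (≈-sym (*-assoc _ _ _)) (≈-trans (*-congʳ (*-comm _ _)) (*-assoc _ _ _)))
  ... | false = weight-sel-insert (t ∘ suc) (p ∘ suc) (p' ∘ suc) i pi p'i (λ j ne → oth (suc j) (suc≢ ne))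

  ξ-E₀ : (t : Fin 0 → Carrier) → ξ R E₀ x y z t ≈ 1#
  ξ-E₀ t = ≈-trans (+-identityʳ _) (≈-trans (*-identityʳ _) (≈-trans (*-identityʳ _) (*-identityʳ _)))

  ξ-E₁ : (t : Fin 0 → Carrier) → ξ R E₁ x y z t ≈ x
  ξ-E₁ t = ≈-trans (+-identityʳ _) (≈-trans (*-identityʳ _) (≈-trans (*-identityʳ _) (≈-trans (*-identityʳ _) (*-identityʳ _))))

  summand-vertex-cong : ∀ {n m} (V V' : BSub n) (E : Fin m → BSub n) t AB Bs → (∀ v → V v ≡ V' v) → summand V E t AB Bs ≡ summand V' E t AB Bs
  summand-vertex-cong V V' E t AB Bs h =
    trans (summand-≡ V E t AB Bs (components-cong V V' (map E AB) (map E AB) h (λ _ _ → refl)) refl refl refl)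
          (sym (summand-≡ V' E t AB Bs refl refl refl refl))

  ξ-term-reindex : ∀ {m N} (q : Fin m → Bool) (VD V' : BSub N) (ED : Fin (length (sel q)) → BSub N) (E' : Fin m → BSub N) t σ →
    (∀ k v → ED k v ≡ E' (lookup (sel q) k) v) → (∀ v → VD v ≡ V' v) →
    (∀ j → T (isAB (σ j)) → T (q j)) →
    ξ-term (record { n = N ; V = VD ; m = length (sel q) ; e = ED }) (t ∘ lookup (sel q)) (σ ∘ lookup (sel q))
      ≈ [ vertexDisjointOn (sel q) E' σ ]· summand V' E' t (sel (isAB ∘ σ)) (sel (isB ∘ σ))
  ξ-term-reindex q VD V' ED E' t σ hE hV hq = ≈-reflexive (cong₂ [_]·_ (vertexDisjointOn-reindex E' (sel q) ED σ hE)
    (trans (summand-vertex-cong VD V' ED (t ∘ lookup (sel q)) (sel (isAB ∘ σ ∘ lookup (sel q))) (sel (isB ∘ σ ∘ lookup (sel q))) hV)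
    (trans (summand-reindex V' E' (sel q) ED t (sel (isAB ∘ σ ∘ lookup (sel q))) (sel (isB ∘ σ ∘ lookup (sel q))) hE)
      (cong₂ (summand V' E' t) (map-lookup-sel-⊆ (isAB ∘ σ) q hq) (map-lookup-sel-⊆ (isB ∘ σ) q λ j b → hq j (isB⇒isAB (σ j) b))))))

  summand-≈ : ∀ {n m} (V : BSub n) (E : Fin m → BSub n) t AB Bs a b l Q →
    components V (map E AB) ≡ a → components (sectionVertices E Bs) (map E Bs) ≡ b → length AB ≡ l → weight t AB ≈ Q →
    summand V E t AB Bs ≈ pow R x (a ∸ b) * pow R y (l ∸ b) * pow R z b * Q
  summand-≈ V E t AB Bs a b l Q refl refl refl hQ = *-congˡ hQ

  module CM = CMS *-commutativeMonoid

  module DeletionContraction (H : Hypergraph) (wf : WellFormed H) (t : Fin (m H) → Carrier) (i : Fin (m H)) where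
    f : BSub (n H)
    f = e H i
    neq : Fin (m H) → Bool
    neq j = not ⌊ j ≟ i ⌋
    perp : Fin (m H) → Bool
    perp j = not ⌊ j ≟ i ⌋ ∧ disjointB (e H j) f
    contracted : Fin (m H) → BSub (suc (n H))
    contracted j = contractEdge f (e H j)
    extractedV : BSub (n H)
    extractedV v = V H v ∧ not (f v)
    w0 : Fin (n H)
    w0 = proj₁ (proj₂ wf i)
    fw0 : T (f w0)
    fw0 = proj₂ (proj₂ wf i)
    fV : ∀ v → T (f v) → T (V H v)
    fV v = proj₁ wf i v

    ξ-deletion : (Fin (m H) → Lbl) → Carrier
    ξ-deletion σ = [ labelledWithin neq σ ]· ξ-term (deletion H i) (t ∘ lookup (neqIdx H i)) (σ ∘ lookup (neqIdx H i))

    ξ-contraction : (Fin (m H) → Lbl) → Carrier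
    ξ-contraction σ = [ labelledWithin neq σ ]· ξ-term (contraction H i) (t ∘ lookup (neqIdx H i)) (σ ∘ lookup (neqIdx H i))

    ξ-extraction : (Fin (m H) → Lbl) → Carrier
    ξ-extraction σ = [ labelledWithin perp σ ]· ξ-term (extraction H i) (t ∘ lookup (perpIdx H i)) (σ ∘ lookup (perpIdx H i))

    neq-≢ : ∀ j → ¬ (j ≡ i) → T (neq j)
    neq-≢ j ne = T-not⁺ (λ t → ne (≟-sound t))

    neq-i : T (neq i) → ⊥
    neq-i t = T-not⁻ t (≟-refl i)

    contracted-nonempty : ∀ L → All (λ g → Σ (Fin (suc (n H))) λ v → T (g v)) (map contracted L)
    contracted-nonempty [] = []
    contracted-nonempty (j ∷ L) = ne j ∷ contracted-nonempty L
      where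
      ne : ∀ j → Σ (Fin (suc (n H))) λ v → T (contracted j v)
      ne j with proj₂ wf j
      ... | w , ew with T-dec (f w)
      ...   | inj₁ fw = zero , contractEdge-zero⁺ f (e H j) w ew fw
      ...   | inj₂ nfw = suc w , contractEdge-suc⁺ f (e H j) w ew nfw

    -- σA and σB move i from out into A and into B.  Whether an edge of B meets
    -- eᵢ (meetsB) decides which shape their summands take.
    module OutAt (σ : Fin (m H) → Lbl) (σi : σ i ≡ out) where
      σA = relabel σ i inA
      σB = relabel σ i inB
      ABσ = sel (isAB ∘ σ)
      Bσ = sel (isB ∘ σ)

      ne-AB : ∀ j → T (isAB (σ j)) → ¬ (j ≡ i)
      ne-AB j t refl rewrite σi = t

      ne-out : ∀ j → ¬ (σ j ≡ out) → ¬ (j ≡ i)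
      ne-out j h refl = h σi

      deletion-term : ξ-term H t σ ≈ ξ-term (deletion H i) (t ∘ lookup (neqIdx H i)) (σ ∘ lookup (neqIdx H i))
      deletion-term = ≈-sym (≈-trans (ξ-term-reindex neq (V H) (V H) (e H ∘ lookup (neqIdx H i)) (e H) t σ (λ _ _ → refl) (λ _ → refl)
                          (λ j tj → neq-≢ j (ne-AB j tj)))
                  (≈-reflexive (cong (λ b → [ b ]· summand (V H) (e H) t ABσ Bσ)
                     (T-ext (λ tv → ⇒vdPair H σ (vertexDisjointOn⇒ (sel neq) (e H) σ (λ a h → ∈-sel neq (neq-≢ a (ne-out a h))) tv))
                            (λ tv → vertexDisjoint⇒On (sel neq) (e H) σ (vdPair⇒ H σ tv))))))

      isAB-relabel-at : ∀ l → ¬ (l ≡ out) → isAB (relabel σ i l i) ≡ true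
      isAB-relabel-at out h = ⊥-elim (h refl)
      isAB-relabel-at inA h rewrite relabel-at σ i inA = refl
      isAB-relabel-at inB h rewrite relabel-at σ i inB = refl

      isAB-σi : isAB (σ i) ≡ false
      isAB-σi rewrite σi = refl
      isB-σi : isB (σ i) ≡ false
      isB-σi rewrite σi = refl

      isAB-relabel-elsewhere : ∀ l j → ¬ (j ≡ i) → isAB (relabel σ i l j) ≡ isAB (σ j)
      isAB-relabel-elsewhere l j ne = cong isAB (relabel-elsewhere σ i l j ne)
      isB-relabel-elsewhere : ∀ l j → ¬ (j ≡ i) → isB (relabel σ i l j) ≡ isB (σ j)
      isB-relabel-elsewhere l j ne = cong isB (relabel-elsewhere σ i l j ne)

      AB-any : ∀ l → ¬ (l ≡ out) → ∀ (h : Fin (m H) → Bool) → any h (sel (isAB ∘ relabel σ i l)) ≡ (h i ∨ any h ABσ)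
      AB-any l nl = Insert.any-sel-insert (isAB ∘ σ) (isAB ∘ relabel σ i l) i isAB-σi (isAB-relabel-at l nl) (isAB-relabel-elsewhere l)

      AB-len : ∀ l → ¬ (l ≡ out) → length (sel (isAB ∘ relabel σ i l)) ≡ suc (length ABσ)
      AB-len l nl = countFin-insert (isAB ∘ σ) (isAB ∘ relabel σ i l) i isAB-σi (isAB-relabel-at l nl) (isAB-relabel-elsewhere l)

      AB-prod : ∀ l → ¬ (l ≡ out) → weight t (sel (isAB ∘ relabel σ i l)) ≈ t i * weight t ABσ
      AB-prod l nl = weight-sel-insert t (isAB ∘ σ) (isAB ∘ relabel σ i l) i isAB-σi (isAB-relabel-at l nl) (isAB-relabel-elsewhere l)

      B-any : ∀ (h : Fin (m H) → Bool) → any h (sel (isB ∘ σB)) ≡ (h i ∨ any h Bσ)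
      B-any = Insert.any-sel-insert (isB ∘ σ) (isB ∘ σB) i isB-σi (cong isB (relabel-at σ i inB)) (isB-relabel-elsewhere inB)

      B-of-σA : sel (isB ∘ σA) ≡ Bσ
      B-of-σA = sel-cong go
        where
        go : ∀ j → isB (σA j) ≡ isB (σ j)
        go j with j ≟ i
        ... | yes refl rewrite σi = refl
        ... | no ne = refl

      components-AB-insert : ∀ l → ¬ (l ≡ out) → components (V H) (map (e H) (sel (isAB ∘ relabel σ i l))) ≡ components (V H) (f ∷ map (e H) ABσ)
      components-AB-insert l nl = components-cong (V H) (V H) _ _ (λ _ → refl) λ a b →
        trans (adjB-map (e H) (sel (isAB ∘ relabel σ i l)) a b) (trans (AB-any l nl (λ j → e H j a ∧ e H j b)) (cong (f a ∧ f b ∨_) (sym (adjB-map (e H) ABσ a b))))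

      length-B≤length-AB : length Bσ ≤ length ABσ
      length-B≤length-AB = countFin-mono (isB ∘ σ) (isAB ∘ σ) (λ j → isB⇒isAB (σ j))

      components-Bc≤length : components (sectionVertices contracted Bσ) (map contracted Bσ) ≤ length ABσ
      components-Bc≤length = ≤-trans (components-section≤edgeCount contracted Bσ (contracted-nonempty Bσ)) length-B≤length-AB

      contraction-term : ∀ (ρ : _) → ρ ≡ σ ∘ lookup (neqIdx H i) →
        ξ-term (contraction H i) (t ∘ lookup (neqIdx H i)) ρ ≈ [ vertexDisjointOn (sel neq) contracted σ ]· summand (contractVertices (V H) f) contracted t ABσ Bσ
      contraction-term ρ refl = ξ-term-reindex neq (V (contraction H i)) (contractVertices (V H) f) (e (contraction H i)) contracted t σ
         hE hV (λ j tj → neq-≢ j (ne-AB j tj))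
        where
        hE : ∀ k v → e (contraction H i) k v ≡ contracted (lookup (sel neq) k) v
        hE k zero = refl
        hE k (suc v) = refl
        hV : ∀ v → V (contraction H i) v ≡ contractVertices (V H) f v
        hV zero = refl
        hV (suc v) = refl

      components-AB-contract : components (V H) (f ∷ map (e H) ABσ) ≡ components (contractVertices (V H) f) (map contracted ABσ)
      components-AB-contract = trans (Contract.components-contract (V H) f (map (e H) ABσ) w0 fw0 fV) (cong (components (contractVertices (V H) f)) (sym (map-∘ ABσ)))

      meetsB : Bool
      meetsB = any (λ j → not (disjointB (e H j) f)) Bσ

      B-avoids : (T meetsB → ⊥) → ∀ j → σ j ≡ inB → T (disjointB (e H j) f)
      B-avoids nM j ej with T-dec (disjointB (e H j) f)
      ... | inj₁ d = d
      ... | inj₂ nd = ⊥-elim (nM (any-intro (λ j → not (disjointB (e H j) f)) (∈-sel (isB ∘ σ) (subst (T ∘ isB) (sym ej) tt)) (T-not⁺ nd)))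

      B-meets : T meetsB → Σ (Fin (m H)) λ j → σ j ≡ inB × (T (disjointB (e H j) f) → ⊥)
      B-meets tM with any-elim (λ j → not (disjointB (e H j) f)) Bσ tM
      ... | j , mj , nd = j , isB⇒≡inB (σ j) (∈-sel⁻ (isB ∘ σ) mj) , T-not⁻ nd

      B-edges-avoid : (T meetsB → ⊥) → ∀ g → g ∈ map (e H) Bσ → T (disjointB g f)
      B-edges-avoid nM g mg with ∈-map⁻ (e H) mg
      ... | j , mj , refl = B-avoids nM j (isB⇒≡inB (σ j) (∈-sel⁻ (isB ∘ σ) mj))

      mapc : map (contractEdge f) (map (e H) Bσ) ≡ map contracted Bσ
      mapc = sym (map-∘ Bσ)

      components-B-shift : (T meetsB → ⊥) → components (sectionVertices (e H) Bσ) (map (e H) Bσ) ≡ components (sectionVertices contracted Bσ) (map contracted Bσ)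
      components-B-shift nM = trans (components-cong _ _ _ _ (sectionVertices≡edgeUnion (e H) Bσ) (λ _ _ → refl))
        (trans (Shift.components-shift f (map (e H) Bσ) (B-edges-avoid nM))
          (trans (cong (λ L → components (edgeUnion L) L) mapc) (components-cong _ _ _ _ (λ v → sym (sectionVertices≡edgeUnion contracted Bσ v)) (λ _ _ → refl))))

      components-B-insert : components (sectionVertices (e H) (sel (isB ∘ σB))) (map (e H) (sel (isB ∘ σB))) ≡ components (λ v → f v ∨ sectionVertices (e H) Bσ v) (f ∷ map (e H) Bσ)
      components-B-insert = components-cong _ _ _ _ (λ v → B-any (λ j → e H j v)) λ a b →
        trans (adjB-map (e H) (sel (isB ∘ σB)) a b) (trans (B-any (λ j → e H j a ∧ e H j b)) (cong (f a ∧ f b ∨_) (sym (adjB-map (e H) Bσ a b))))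

      components-B-contract : T meetsB → components (λ v → f v ∨ sectionVertices (e H) Bσ v) (f ∷ map (e H) Bσ) ≡ components (sectionVertices contracted Bσ) (map contracted Bσ)
      components-B-contract tM = trans (Contract.components-contract (λ v → f v ∨ sectionVertices (e H) Bσ v) f (map (e H) Bσ) w0 fw0 (λ v fv → T-∨⁺ˡ fv))
        (trans (cong (components (contractVertices (λ v → f v ∨ sectionVertices (e H) Bσ v) f)) mapc) (components-cong _ _ _ _ hW (λ _ _ → refl)))
        where
        hW : ∀ v → contractVertices (λ v → f v ∨ sectionVertices (e H) Bσ v) f v ≡ sectionVertices contracted Bσ v
        hW zero = sym (T⇒≡true (let (j , ej , nd) = B-meets tM in
           any-intro (λ j → contracted j zero) (∈-sel (isB ∘ σ) (subst (T ∘ isB) (sym ej) tt)) (T-not⁺ nd)))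
        hW (suc w) = T-ext to fro
          where
          to : T ((f w ∨ sectionVertices (e H) Bσ w) ∧ not (f w)) → T (sectionVertices contracted Bσ (suc w))
          to h with T-∨⁻ {f w} (T-∧⁻ˡ {f w ∨ sectionVertices (e H) Bσ w} h)
          ... | inj₁ fw = ⊥-elim (T-not⁻ (T-∧⁻ʳ {f w ∨ sectionVertices (e H) Bσ w} h) fw)
          ... | inj₂ wb with any-elim (λ j → e H j w) Bσ wb
          ...   | j , mj , ew = any-intro (λ j → contracted j (suc w)) mj (contractEdge-suc⁺ f (e H j) w ew (T-not⁻ (T-∧⁻ʳ {f w ∨ sectionVertices (e H) Bσ w} h)))
          fro : T (sectionVertices contracted Bσ (suc w)) → T ((f w ∨ sectionVertices (e H) Bσ w) ∧ not (f w))
          fro h with any-elim (λ j → contracted j (suc w)) Bσ h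
          ... | j , mj , cw = T-∧⁺ {f w ∨ sectionVertices (e H) Bσ w} (T-∨⁺ʳ {f w} (any-intro (λ j → e H j w) mj (contractEdge-suc⁻ f (e H j) w cw))) (T-not⁺ (contractEdge-suc-∉ f (e H j) w cw))

      djAB : T (labelledWithin perp σ) → ∀ g → g ∈ map (e H) ABσ → ∀ v → T (g v) → T (f v) → ⊥
      djAB ta g mg v gv fv with ∈-map⁻ (e H) mg
      ... | j , mj , refl = disjointB⁻ {f = e H j} {g = f} dj v gv fv
        where
        qj : T (perp j ∨ isOut (σ j))
        qj = allFin-elim (λ j → perp j ∨ isOut (σ j)) ta j
        dj : T (disjointB (e H j) f)
        dj with T-∨⁻ {perp j} qj
        ... | inj₁ q = T-∧⁻ʳ {not ⌊ j ≟ i ⌋} q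
        ... | inj₂ o = ⊥-elim (isAB⇒≢out (σ j) (∈-sel⁻ (isAB ∘ σ) mj) (isOut⇒≡out (σ j) o))

      components-AB-extract : T (labelledWithin perp σ) → components (V H) (f ∷ map (e H) ABσ) ≡ suc (components extractedV (map (e H) ABσ))
      components-AB-extract ta = Extract.components-extract (V H) f (map (e H) ABσ) w0 fw0 fV (djAB ta)

      components-B-extract : (T meetsB → ⊥) → components (λ v → f v ∨ sectionVertices (e H) Bσ v) (f ∷ map (e H) Bσ) ≡ suc (components (sectionVertices (e H) Bσ) (map (e H) Bσ))
      components-B-extract nM = trans (Extract.components-extract (λ v → f v ∨ sectionVertices (e H) Bσ v) f (map (e H) Bσ) w0 fw0 (λ v fv → T-∨⁺ˡ fv)
                           (λ g mg v gv fv → disjointB⁻ {f = g} {g = f} (B-edges-avoid nM g mg) v gv fv))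
                  (cong suc (components-cong _ _ _ _ hW (λ _ _ → refl)))
        where
        hW : ∀ v → ((f v ∨ sectionVertices (e H) Bσ v) ∧ not (f v)) ≡ sectionVertices (e H) Bσ v
        hW v = T-ext (λ h → [ (λ fv → ⊥-elim (T-not⁻ (T-∧⁻ʳ {f v ∨ sectionVertices (e H) Bσ v} h) fv)) , (λ w → w) ]′ (T-∨⁻ {f v} (T-∧⁻ˡ {f v ∨ sectionVertices (e H) Bσ v} h)))
                     (λ w → T-∧⁺ {f v ∨ sectionVertices (e H) Bσ v} (T-∨⁺ʳ {f v} w) (T-not⁺ λ fv →
                        let (j , mj , ev) = any-elim (λ j → e H j v) Bσ w in
                        disjointB⁻ {f = e H j} {g = f} (B-edges-avoid nM (e H j) (∈-map⁺ (e H) mj)) v ev fv))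

      regroup-y : ∀ X Y Z T' Q → X * (y * Y) * Z * (T' * Q) ≈ y * T' * (X * Y * Z * Q)
      regroup-y X Y Z T' Q = CM.solve 6 (λ X Y Z T' Q y' → ((X CM.⊕ (y' CM.⊕ Y)) CM.⊕ Z) CM.⊕ (T' CM.⊕ Q) CM.⊜ (y' CM.⊕ T') CM.⊕ (((X CM.⊕ Y) CM.⊕ Z) CM.⊕ Q)) ≈-refl X Y Z T' Q y

      regroup-z : ∀ X Y Z T' Q → X * Y * (z * Z) * (T' * Q) ≈ z * T' * (X * Y * Z * Q)
      regroup-z X Y Z T' Q = CM.solve 6 (λ X Y Z T' Q z' → ((X CM.⊕ Y) CM.⊕ (z' CM.⊕ Z)) CM.⊕ (T' CM.⊕ Q) CM.⊜ (z' CM.⊕ T') CM.⊕ (((X CM.⊕ Y) CM.⊕ Z) CM.⊕ Q)) ≈-refl X Y Z T' Q z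

      aC = components (contractVertices (V H) f) (map contracted ABσ)
      bC = components (sectionVertices contracted Bσ) (map contracted Bσ)
      lσ = length ABσ
      Pσ = weight t ABσ

      suc-length∸ : suc lσ ∸ bC ≡ suc (lσ ∸ bC)
      suc-length∸ = ℕP.+-∸-assoc 1 components-Bc≤length

      summand-contraction : summand (contractVertices (V H) f) contracted t ABσ Bσ ≈ pow R x (aC ∸ bC) * pow R y (lσ ∸ bC) * pow R z bC * Pσ
      summand-contraction = summand-≈ (contractVertices (V H) f) contracted t ABσ Bσ aC bC lσ Pσ refl refl refl ≈-refl

      y-factor : pow R x (aC ∸ bC) * pow R y (suc lσ ∸ bC) * pow R z bC * (t i * Pσ) ≈ y * t i * summand (contractVertices (V H) f) contracted t ABσ Bσ
      y-factor = ≈-trans (*-congʳ (*-congʳ (*-congˡ (≈-reflexive (cong (pow R y) suc-length∸)))))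
                   (≈-trans (regroup-y (pow R x (aC ∸ bC)) (pow R y (lσ ∸ bC)) (pow R z bC) (t i) Pσ) (*-congˡ (≈-sym summand-contraction)))

      summand-A : (T meetsB → ⊥) → summand (V H) (e H) t (sel (isAB ∘ σA)) (sel (isB ∘ σA)) ≈ y * t i * summand (contractVertices (V H) f) contracted t ABσ Bσ
      summand-A nM = ≈-trans (summand-≈ (V H) (e H) t (sel (isAB ∘ σA)) (sel (isB ∘ σA)) aC bC (suc lσ) (t i * Pσ)
                       (trans (components-AB-insert inA (λ ())) components-AB-contract)
                       (trans (cong (λ L → components (sectionVertices (e H) L) (map (e H) L)) B-of-σA) (components-B-shift nM))
                       (AB-len inA (λ ())) (AB-prod inA (λ ())))
                y-factor

      summand-B-meets : T meetsB → summand (V H) (e H) t (sel (isAB ∘ σB)) (sel (isB ∘ σB)) ≈ y * t i * summand (contractVertices (V H) f) contracted t ABσ Bσ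
      summand-B-meets tM = ≈-trans (summand-≈ (V H) (e H) t (sel (isAB ∘ σB)) (sel (isB ∘ σB)) aC bC (suc lσ) (t i * Pσ)
                       (trans (components-AB-insert inB (λ ())) components-AB-contract)
                       (trans components-B-insert (components-B-contract tM))
                       (AB-len inB (λ ())) (AB-prod inB (λ ())))
                y-factor

      aE = components extractedV (map (e H) ABσ)
      bE = components (sectionVertices (e H) Bσ) (map (e H) Bσ)

      summand-B-avoids : (T meetsB → ⊥) → T (labelledWithin perp σ) → summand (V H) (e H) t (sel (isAB ∘ σB)) (sel (isB ∘ σB)) ≈ z * t i * summand extractedV (e H) t ABσ Bσ
      summand-B-avoids nM ta = ≈-trans (summand-≈ (V H) (e H) t (sel (isAB ∘ σB)) (sel (isB ∘ σB)) (suc aE) (suc bE) (suc lσ) (t i * Pσ)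
                       (trans (components-AB-insert inB (λ ())) (components-AB-extract ta))
                       (trans components-B-insert (components-B-extract nM))
                       (AB-len inB (λ ())) (AB-prod inB (λ ())))
                 (≈-trans (regroup-z _ _ _ _ _) (*-congˡ (≈-sym (summand-≈ extractedV (e H) t ABσ Bσ aE bE lσ Pσ refl refl refl ≈-refl))))


      relabel-moved : ∀ l l' b → relabel σ i l b ≡ l' → ¬ (l ≡ l') → ¬ (b ≡ i)
      relabel-moved l l' b e' nl refl = nl (trans (sym (relabel-at σ i l)) e')

      relabel-unmoved : ∀ l l' b → relabel σ i l b ≡ l' → ¬ (b ≡ i) → σ b ≡ l'
      relabel-unmoved l l' b e' ne = trans (sym (relabel-elsewhere σ i l b ne)) e'

      neA : ∀ a → σ a ≡ inA → ¬ (a ≡ i)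
      neA a ea = ne-out a (inA⇒≢out ea)
      neB : ∀ a → σ a ≡ inB → ¬ (a ≡ i)
      neB a ea = ne-out a (inB⇒≢out ea)

      ∈-sel-neq : ∀ a → ¬ (σ a ≡ out) → a ∈ sel neq
      ∈-sel-neq a h = ∈-sel neq (neq-≢ a (ne-out a h))


      vd-A-avoids : (T meetsB → ⊥) → vertexDisjointOn (allFin (m H)) (e H) σA ≡ vertexDisjointOn (sel neq) contracted σ
      vd-A-avoids nM = T-ext to fro
        where
        to : _
        to t' = vertexDisjoint⇒On (sel neq) contracted σ λ a b ea eb →
          contractEdge-disjoint⁺ f (e H a) (e H b) (inj₂ (B-avoids nM b eb)) (λ w eaw ebw → ⊥-elim (disjointB⁻ {f = e H a} {g = e H b}
            (vdPair⇒ H σA t' a b (trans (relabel-elsewhere σ i inA a (neA a ea)) ea) (trans (relabel-elsewhere σ i inA b (neB b eb)) eb)) w eaw ebw))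
        fro : _
        fro t' = ⇒vdPair H σA λ a b eA eB →
          let V' = vertexDisjointOn⇒ (sel neq) contracted σ ∈-sel-neq t'
              nb = relabel-moved inA inB b eB (λ ())
              σb = relabel-unmoved inA inB b eB nb in
          go a b eA σb nb V'
          where
          go : ∀ a b → σA a ≡ inA → σ b ≡ inB → ¬ (b ≡ i) → VertexDisjoint contracted σ → T (disjointB (e H a) (e H b))
          go a b eA σb nb V' with a ≟ i
          ... | yes refl = disjointB-sym {g = e H b} {f} (B-avoids nM b σb)
          ... | no na = let two = proj₂ (contractEdge-disjoint⁻ f (e H a) (e H b) (V' a b eA σb)) in
                        disjointB⁺ {f = e H a} {g = e H b} (λ w ea eb → disjointB⁻ {f = e H b} {g = f} (B-avoids nM b σb) w eb (two w ea eb))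

      vd-A-meets : T meetsB → vertexDisjointOn (allFin (m H)) (e H) σA ≡ false
      vd-A-meets tM = ¬T⇒≡false λ t' → let (b , eb , nd) = B-meets tM in
        nd (disjointB-sym {g = e H i} {e H b} (vdPair⇒ H σA t' i b (relabel-at σ i inA) (trans (relabel-elsewhere σ i inA b (neB b eb)) eb)))

      vd-B-meets : T meetsB → vertexDisjointOn (allFin (m H)) (e H) σB ≡ vertexDisjointOn (sel neq) contracted σ
      vd-B-meets tM = T-ext to fro
        where
        to : _
        to t' = vertexDisjoint⇒On (sel neq) contracted σ λ a b ea eb →
          let V' = vdPair⇒ H σB t'
              σBa = trans (relabel-elsewhere σ i inB a (neA a ea)) ea
              dA = V' a i σBa (relabel-at σ i inB)
              dAB = V' a b σBa (trans (relabel-elsewhere σ i inB b (neB b eb)) eb) in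
          contractEdge-disjoint⁺ f (e H a) (e H b) (inj₁ dA) (λ w eaw ebw → ⊥-elim (disjointB⁻ {f = e H a} {g = e H b} dAB w eaw ebw))
        fro : _
        fro t' = ⇒vdPair H σB λ a b eA eB →
          let V' = vertexDisjointOn⇒ (sel neq) contracted σ ∈-sel-neq t'
              na = relabel-moved inB inA a eA (λ ())
              σa = relabel-unmoved inB inA a eA na
              (c0 , ec0 , nd0) = B-meets tM
              dA = [ (λ d → d) , (λ d → ⊥-elim (nd0 d)) ]′ (proj₁ (contractEdge-disjoint⁻ f (e H a) (e H c0) (V' a c0 σa ec0))) in
          go a b σa dA eB V'
          where
          go : ∀ a b → σ a ≡ inA → T (disjointB (e H a) f) → σB b ≡ inB → VertexDisjoint contracted σ → T (disjointB (e H a) (e H b))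
          go a b σa dA eB V' with b ≟ i
          ... | yes refl = dA
          ... | no nb = let two = proj₂ (contractEdge-disjoint⁻ f (e H a) (e H b) (V' a b σa eB)) in
                        disjointB⁺ {f = e H a} {g = e H b} (λ w ea eb → disjointB⁻ {f = e H a} {g = f} dA w ea (two w ea eb))

      perp-labelled : T (labelledWithin perp σ) → ∀ a → ¬ (σ a ≡ out) → T (perp a)
      perp-labelled ta a h with T-∨⁻ {perp a} (allFin-elim (λ j → perp j ∨ isOut (σ j)) ta a)
      ... | inj₁ q = q
      ... | inj₂ o = ⊥-elim (h (isOut⇒≡out (σ a) o))

      vd-B-avoids : (T meetsB → ⊥) → vertexDisjointOn (allFin (m H)) (e H) σB ≡ (labelledWithin perp σ ∧ vertexDisjointOn (sel perp) (e H) σ)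
      vd-B-avoids nM = T-ext to fro
        where
        to : _
        to t' = T-∧⁺ {labelledWithin perp σ} ao (vertexDisjoint⇒On (sel perp) (e H) σ λ a b ea eb →
                  V' a b (trans (relabel-elsewhere σ i inB a (neA a ea)) ea) (trans (relabel-elsewhere σ i inB b (neB b eb)) eb))
          where
          V' = vdPair⇒ H σB t'
          ao : T (labelledWithin perp σ)
          ao = allFin-intro (λ j → perp j ∨ isOut (σ j)) go
            where
            go : ∀ j → T (perp j ∨ isOut (σ j))
            go j with σ j in ej
            ... | out = T-∨⁺ʳ {perp j} tt
            ... | inA = T-∨⁺ˡ (T-∧⁺ {neq j} (neq-≢ j (neA j ej)) (V' j i (trans (relabel-elsewhere σ i inB j (neA j ej)) ej) (relabel-at σ i inB)))
            ... | inB = T-∨⁺ˡ (T-∧⁺ {neq j} (neq-≢ j (neB j ej)) (B-avoids nM j ej))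
        fro : _
        fro t' = ⇒vdPair H σB λ a b eA eB →
          let ta = T-∧⁻ˡ {labelledWithin perp σ} t'
              V' = vertexDisjointOn⇒ (sel perp) (e H) σ (λ a h → ∈-sel perp (perp-labelled ta a h)) (T-∧⁻ʳ {labelledWithin perp σ} t')
              na = relabel-moved inB inA a eA (λ ())
              σa = relabel-unmoved inB inA a eA na
              dA = T-∧⁻ʳ {neq a} (perp-labelled ta a (inA⇒≢out σa)) in
          go a b σa dA eB V'
          where
          go : ∀ a b → σ a ≡ inA → T (disjointB (e H a) f) → σB b ≡ inB → VertexDisjoint (e H) σ → T (disjointB (e H a) (e H b))
          go a b σa dA eB V' with b ≟ i
          ... | yes refl = dA
          ... | no nb = V' a b σa eB

      extraction-term : T (labelledWithin perp σ) → ξ-term (extraction H i) (t ∘ lookup (perpIdx H i)) (σ ∘ lookup (perpIdx H i)) ≈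
             [ vertexDisjointOn (sel perp) (e H) σ ]· summand extractedV (e H) t ABσ Bσ
      extraction-term ta = ξ-term-reindex perp extractedV extractedV (e H ∘ lookup (sel perp)) (e H) t σ (λ _ _ → refl) (λ _ → refl)
                 (λ j tj → perp-labelled ta j (isAB⇒≢out (σ j) tj))


      FC = ξ-term (contraction H i) (t ∘ lookup (neqIdx H i)) (σ ∘ lookup (neqIdx H i))
      FE = ξ-term (extraction H i) (t ∘ lookup (perpIdx H i)) (σ ∘ lookup (perpIdx H i))

      contraction-term-y : ∀ b → b ≡ vertexDisjointOn (sel neq) contracted σ → [ b ]· (y * t i * summand (contractVertices (V H) f) contracted t ABσ Bσ) ≈ y * t i * FC
      contraction-term-y b refl = ≈-trans ([]·-* b (y * t i) _) (*-congˡ (≈-sym (contraction-term _ refl)))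

      moved-into-AB : ξ-term H t σA + ξ-term H t σB ≈ y * t i * FC + z * t i * ([ labelledWithin perp σ ]· FE)
      moved-into-AB with T-dec meetsB
      ... | inj₁ tM = begin
          ξ-term H t σA + ξ-term H t σB ≈⟨ +-cong ([]·-≡ _ (vd-A-meets tM)) ([]·-≡ _ (vd-B-meets tM)) ⟩
          0# + [ vertexDisjointOn (sel neq) contracted σ ]· summand (V H) (e H) t (sel (isAB ∘ σB)) (sel (isB ∘ σB)) ≈⟨ +-congˡ ([]·-cong (vertexDisjointOn (sel neq) contracted σ) (summand-B-meets tM)) ⟩
          0# + [ vertexDisjointOn (sel neq) contracted σ ]· (y * t i * summand (contractVertices (V H) f) contracted t ABσ Bσ) ≈⟨ +-congˡ (contraction-term-y _ refl) ⟩
          0# + y * t i * FC ≈⟨ +-identityˡ _ ⟩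
          y * t i * FC ≈⟨ ≈-sym (+-identityʳ _) ⟩
          y * t i * FC + 0# ≈⟨ +-congˡ (≈-sym (zeroʳ (z * t i))) ⟩
          y * t i * FC + z * t i * 0# ≈⟨ +-congˡ (*-congˡ ([]·-≡ FE (sym labelledWithin-perp-false))) ⟩
          y * t i * FC + z * t i * ([ labelledWithin perp σ ]· FE) ∎
        where
        labelledWithin-perp-false : labelledWithin perp σ ≡ false
        labelledWithin-perp-false = ¬T⇒≡false λ ta → let (c0 , ec0 , nd0) = B-meets tM in nd0 (T-∧⁻ʳ {neq c0} (perp-labelled ta c0 (inB⇒≢out ec0)))
      ... | inj₂ nM = +-cong A-part B-part
        where
        A-part : ξ-term H t σA ≈ y * t i * FC
        A-part = ≈-trans ([]·-≡ _ (vd-A-avoids nM)) (≈-trans ([]·-cong (vertexDisjointOn (sel neq) contracted σ) (summand-A nM)) (contraction-term-y _ refl))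
        B-part : ξ-term H t σB ≈ z * t i * ([ labelledWithin perp σ ]· FE)
        B-part = ≈-trans ([]·-≡ _ (vd-B-avoids nM)) (go (T-dec (labelledWithin perp σ)))
          where
          go : T (labelledWithin perp σ) ⊎ (T (labelledWithin perp σ) → ⊥) →
               [ labelledWithin perp σ ∧ vertexDisjointOn (sel perp) (e H) σ ]· summand (V H) (e H) t (sel (isAB ∘ σB)) (sel (isB ∘ σB)) ≈ z * t i * ([ labelledWithin perp σ ]· FE)
          go (inj₁ ta) rewrite T⇒≡true ta =
            ≈-trans ([]·-cong (vertexDisjointOn (sel perp) (e H) σ) (summand-B-avoids nM ta)) (≈-trans ([]·-* _ (z * t i) _) (*-congˡ (≈-sym (extraction-term ta))))
          go (inj₂ nta) rewrite ¬T⇒≡false nta = ≈-sym (zeroʳ _)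

      labelledWithin-neq : labelledWithin neq σ ≡ true
      labelledWithin-neq = T⇒≡true (allFin-intro (λ j → neq j ∨ isOut (σ j)) go)
        where
        go : ∀ j → T (neq j ∨ isOut (σ j))
        go j with j ≟ i
        ... | yes refl = subst (T ∘ isOut) (sym σi) tt
        ... | no ne = tt

      grouped : outAt (ξ-term H t) i σ ≈ ξ-deletion σ + y * t i * ξ-contraction σ + z * t i * ξ-extraction σ
      grouped rewrite σi | labelledWithin-neq = ≈-trans (+-cong deletion-term moved-into-AB) (≈-sym (+-assoc _ _ _))


    labelledWithin-false : ∀ σ → ¬ (σ i ≡ out) → ∀ q → (T (q i) → ⊥) → labelledWithin q σ ≡ false
    labelledWithin-false σ h q nq = ¬T⇒≡false λ ta → [ nq , (λ o → h (isOut⇒≡out (σ i) o)) ]′ (T-∨⁻ {q i} (allFin-elim (λ j → q j ∨ isOut (σ j)) ta i))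

    grouped-zero : ∀ σ → ¬ (σ i ≡ out) → 0# ≈ ξ-deletion σ + y * t i * ξ-contraction σ + z * t i * ξ-extraction σ
    grouped-zero σ h = ≈-sym (≈-trans
      (+-cong (+-cong ([]·-≡ _ neq-false) (*-congˡ ([]·-≡ _ neq-false))) (*-congˡ ([]·-≡ _ perp-false)))
      (≈-trans (+-cong (+-cong ≈-refl (zeroʳ _)) (zeroʳ _)) (≈-trans (+-identityʳ _) (+-identityʳ _))))
      where
      neq-false = labelledWithin-false σ h neq neq-i
      perp-false = labelledWithin-false σ h perp (λ q → neq-i (T-∧⁻ˡ {neq i} q))

    grouped-all : ∀ σ → outAt (ξ-term H t) i σ ≈ ξ-deletion σ + y * t i * ξ-contraction σ + z * t i * ξ-extraction σ
    grouped-all σ = go (σ i) refl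
      where
      go : ∀ l → σ i ≡ l → outAt (ξ-term H t) i σ ≈ ξ-deletion σ + y * t i * ξ-contraction σ + z * t i * ξ-extraction σ
      go out eσ = OutAt.grouped σ eσ
      go inA eσ = ≈-trans ([]·-≡ _ (cong isOut eσ)) (grouped-zero σ (inA⇒≢out eσ))
      go inB eσ = ≈-trans ([]·-≡ _ (cong isOut eσ)) (grouped-zero σ (inB⇒≢out eσ))

    recurrence : ξ R H x y z t ≈ ξ R (deletion H i) x y z (t ∘ lookup (neqIdx H i))
             + y * t i * ξ R (contraction H i) x y z (t ∘ lookup (neqIdx H i))
             + z * t i * ξ R (extraction H i) x y z (t ∘ lookup (perpIdx H i))
    recurrence = begin
      Σlab (m H) (ξ-term H t) ≈⟨ Σlab-outAt (m H) (ξ-term H t) (ξ-term-extensional H t) i ⟩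
      Σlab (m H) (outAt (ξ-term H t) i) ≈⟨ Σlab-cong (m H) grouped-all ⟩
      Σlab (m H) (λ σ → ξ-deletion σ + y * t i * ξ-contraction σ + z * t i * ξ-extraction σ) ≈⟨ Σl-+ (labellings (m H)) (λ σ → ξ-deletion σ + y * t i * ξ-contraction σ) (λ σ → z * t i * ξ-extraction σ) ⟩
      Σlab (m H) (λ σ → ξ-deletion σ + y * t i * ξ-contraction σ) + Σlab (m H) (λ σ → z * t i * ξ-extraction σ)
        ≈⟨ +-cong (≈-trans (Σl-+ (labellings (m H)) ξ-deletion (λ σ → y * t i * ξ-contraction σ)) (+-congˡ (Σl-* (labellings (m H)) (y * t i) ξ-contraction)))
                  (Σl-* (labellings (m H)) (z * t i) ξ-extraction) ⟩
      Σlab (m H) ξ-deletion + y * t i * Σlab (m H) ξ-contraction + z * t i * Σlab (m H) ξ-extraction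
        ≈⟨ +-cong (+-cong (≈-sym (Σlab-restrict (m H) neq FD (ξ-term-extensional (deletion H i) _)))
                          (*-congˡ (≈-sym (Σlab-restrict (m H) neq FC' (ξ-term-extensional (contraction H i) _)))))
                  (*-congˡ (≈-sym (Σlab-restrict (m H) perp FE' (ξ-term-extensional (extraction H i) _)))) ⟩
      Σlab (length (neqIdx H i)) FD + y * t i * Σlab (length (neqIdx H i)) FC' + z * t i * Σlab (length (perpIdx H i)) FE' ∎
      where
      FD = ξ-term (deletion H i) (t ∘ lookup (neqIdx H i))
      FC' = ξ-term (contraction H i) (t ∘ lookup (neqIdx H i))
      FE' = ξ-term (extraction H i) (t ∘ lookup (perpIdx H i))

  module DisjointUnion (H1 H2 : Hypergraph) (wf1 : WellFormed H1) (wf2 : WellFormed H2)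
           (t1 : Fin (m H1) → Carrier) (t2 : Fin (m H2) → Carrier) where
    m1 = m H1
    m2 = m H2
    H = H1 ⊔ᴴ H2
    e1 = e H1
    e2 = e H2
    tj = joinW H1 H2 t1 t2

    module Joined (σ1 : Fin m1 → Lbl) (σ2 : Fin m2 → Lbl) where
      open JoinedLabelling H1 H2 σ1 σ2 using (σ; inl; inr; vdPair-join; sel-joined; sectionVertices-joined; components-joined)

      AB1 = sel (isAB ∘ σ1)
      AB2 = sel (isAB ∘ σ2)
      B1 = sel (isB ∘ σ1)
      B2 = sel (isB ∘ σ2)
      a1 = components (V H1) (map e1 AB1)
      a2 = components (V H2) (map e2 AB2)
      b1 = components (sectionVertices e1 B1) (map e1 B1)
      b2 = components (sectionVertices e2 B2) (map e2 B2)
      l1 = length AB1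
      l2 = length AB2
      P1 = weight t1 AB1
      P2 = weight t2 AB2

      regroup-⊔ : ∀ X1 X2 Y1 Y2 Z1 Z2 Q1 Q2 → X1 * X2 * (Y1 * Y2) * (Z1 * Z2) * (Q1 * Q2) ≈ (X1 * Y1 * Z1 * Q1) * (X2 * Y2 * Z2 * Q2)
      regroup-⊔ X1 X2 Y1 Y2 Z1 Z2 Q1 Q2 = CM.solve 8 (λ X1 X2 Y1 Y2 Z1 Z2 Q1 Q2 →
        (((X1 CM.⊕ X2) CM.⊕ (Y1 CM.⊕ Y2)) CM.⊕ (Z1 CM.⊕ Z2)) CM.⊕ (Q1 CM.⊕ Q2) CM.⊜
        (((X1 CM.⊕ Y1) CM.⊕ Z1) CM.⊕ Q1) CM.⊕ (((X2 CM.⊕ Y2) CM.⊕ Z2) CM.⊕ Q2)) ≈-refl X1 X2 Y1 Y2 Z1 Z2 Q1 Q2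

      summand-joined : T (vdPair H1 σ1) → T (vdPair H2 σ2) →
        summand (V H) (e H) tj (sel (isAB ∘ σ)) (sel (isB ∘ σ)) ≈ summand (V H1) e1 t1 AB1 B1 * summand (V H2) e2 t2 AB2 B2
      summand-joined v1 v2 rewrite sel-joined isAB | sel-joined isB = begin
        summand (V H) (e H) tj (map inl AB1 ++ map inr AB2) (map inl B1 ++ map inr B2)
          ≈⟨ summand-≈ (V H) (e H) tj (map inl AB1 ++ map inr AB2) (map inl B1 ++ map inr B2) (a1 ℕ.+ a2) (b1 ℕ.+ b2) (l1 ℕ.+ l2) (P1 * P2)
               (components-joined (V H1) (V H2) AB1 AB2 (V H) (λ _ → refl))
               (components-joined (sectionVertices e1 B1) (sectionVertices e2 B2) B1 B2 _ (sectionVertices-joined B1 B2))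
               (trans (length-++ (map inl AB1)) (cong₂ ℕ._+_ (length-map inl AB1) (length-map inr AB2)))
               (≈-trans (weight-++ tj (map inl AB1) (map inr AB2))
                  (*-cong (weight-map-cong tj t1 inl AB1 (joinLabels-↑ˡ m1 t1 t2)) (weight-map-cong tj t2 inr AB2 (joinLabels-↑ʳ m1 t1 t2)))) ⟩
        pow R x ((a1 ℕ.+ a2) ∸ (b1 ℕ.+ b2)) * pow R y ((l1 ℕ.+ l2) ∸ (b1 ℕ.+ b2)) * pow R z (b1 ℕ.+ b2) * (P1 * P2)
          ≈⟨ *-congʳ (*-congʳ (*-cong (≈-reflexive (cong (pow R x) (+-∸-+ (SectionBounds.components-section≤components H1 wf1 σ1 v1) (SectionBounds.components-section≤components H2 wf2 σ2 v2))))
                                      (≈-reflexive (cong (pow R y) (+-∸-+ (SectionBounds.components-section≤length H1 wf1 σ1) (SectionBounds.components-section≤length H2 wf2 σ2)))))) ⟩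
        pow R x ((a1 ∸ b1) ℕ.+ (a2 ∸ b2)) * pow R y ((l1 ∸ b1) ℕ.+ (l2 ∸ b2)) * pow R z (b1 ℕ.+ b2) * (P1 * P2)
          ≈⟨ *-congʳ (*-cong (*-cong (pow-+ x (a1 ∸ b1) (a2 ∸ b2)) (pow-+ y (l1 ∸ b1) (l2 ∸ b2))) (pow-+ z b1 b2)) ⟩
        pow R x (a1 ∸ b1) * pow R x (a2 ∸ b2) * (pow R y (l1 ∸ b1) * pow R y (l2 ∸ b2)) * (pow R z b1 * pow R z b2) * (P1 * P2)
          ≈⟨ regroup-⊔ _ _ _ _ _ _ _ _ ⟩
        (pow R x (a1 ∸ b1) * pow R y (l1 ∸ b1) * pow R z b1 * P1) * (pow R x (a2 ∸ b2) * pow R y (l2 ∸ b2) * pow R z b2 * P2)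
          ≈⟨ ≈-sym (*-cong (summand-≈ (V H1) e1 t1 AB1 B1 a1 b1 l1 P1 refl refl refl ≈-refl)
                         (summand-≈ (V H2) e2 t2 AB2 B2 a2 b2 l2 P2 refl refl refl ≈-refl)) ⟩
        summand (V H1) e1 t1 AB1 B1 * summand (V H2) e2 t2 AB2 B2 ∎

      ξ-term-joined : ξ-term H tj σ ≈ ξ-term H1 t1 σ1 * ξ-term H2 t2 σ2
      ξ-term-joined rewrite vdPair-join with T-dec (vdPair H1 σ1) | T-dec (vdPair H2 σ2)
      ... | inj₁ v1 | inj₁ v2 rewrite T⇒≡true v1 | T⇒≡true v2 = summand-joined v1 v2
      ... | inj₁ v1 | inj₂ nv2 rewrite T⇒≡true v1 | ¬T⇒≡false nv2 = ≈-sym (zeroʳ _)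
      ... | inj₂ nv1 | _ rewrite ¬T⇒≡false nv1 = ≈-sym (zeroˡ _)

    ξ-⊔ : ξ R H x y z tj ≈ ξ R H1 x y z t1 * ξ R H2 x y z t2
    ξ-⊔ = begin
      Σlab (m1 ℕ.+ m2) (ξ-term H tj) ≈⟨ Σlab-join m1 m2 (ξ-term H tj) (ξ-term-extensional H tj) ⟩
      Σlab m1 (λ σ1 → Σlab m2 (λ σ2 → ξ-term H tj (joinLabels m1 σ1 σ2))) ≈⟨ Σlab-cong m1 (λ σ1 → Σlab-cong m2 (λ σ2 → Joined.ξ-term-joined σ1 σ2)) ⟩
      Σlab m1 (λ σ1 → Σlab m2 (λ σ2 → ξ-term H1 t1 σ1 * ξ-term H2 t2 σ2)) ≈⟨ Σlab-cong m1 (λ σ1 → ≈-trans (Σl-* (labellings m2) (ξ-term H1 t1 σ1) (ξ-term H2 t2)) (*-comm _ _)) ⟩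
      Σlab m1 (λ σ1 → Σlab m2 (ξ-term H2 t2) * ξ-term H1 t1 σ1) ≈⟨ Σl-* (labellings m1) (Σlab m2 (ξ-term H2 t2)) (ξ-term H1 t1) ⟩
      Σlab m2 (ξ-term H2 t2) * Σlab m1 (ξ-term H1 t1) ≈⟨ *-comm _ _ ⟩
      Σlab m1 (ξ-term H1 t1) * Σlab m2 (ξ-term H2 t2) ∎

mainTheorem1 : ∀ {c ℓ} (R : CommutativeRing c ℓ) →
    let open CommutativeRing R in
    (x y z : Carrier) →
    ((t : Fin 0 → Carrier) → ξ R E₀ x y z t ≈ 1#)
    × ((t : Fin 0 → Carrier) → ξ R E₁ x y z t ≈ x)
    × ((H₁ H₂ : Hypergraph) → WellFormed H₁ → WellFormed H₂ →
    (t₁ : Fin (m H₁) → Carrier) (t₂ : Fin (m H₂) → Carrier) →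
    ξ R (H₁ ⊔ᴴ H₂) x y z (joinW H₁ H₂ t₁ t₂) ≈ ξ R H₁ x y z t₁ * ξ R H₂ x y z t₂)
    × ((H : Hypergraph) → WellFormed H → (t : Fin (m H) → Carrier) (i : Fin (m H)) →
    ξ R H x y z t
    ≈ ξ R (deletion H i) x y z (t ∘ lookup (neqIdx H i))
    + y * t i * ξ R (contraction H i) x y z (t ∘ lookup (neqIdx H i))
    + z * t i * ξ R (extraction H i) x y z (t ∘ lookup (perpIdx H i)))
mainTheorem1 R x y z = ξ-E₀ , ξ-E₁ , DisjointUnion.ξ-⊔ , DeletionContraction.recurrence
  where open Polynomial R x y z
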